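{- The polynomials $B_k$, $k\ge0$, form a basis over $\mathbb{Z}[q,q^{ -1}]$ of the ring $A_q$.
   Context: Let $q$ be an indeterminate, $[n]_q=(q^n-1)/(q-1)$ for $n\in\mathbb{Z}$ and $[k]!_q=[1]_q\cdots[k]_q$. Let $A_q$ be the subring of $\mathbb{Q}(q)[x]$ consisting of the polynomials $P$ such that $P([n]_q)\in\mathbb{Z}[q,q^{ -1}]$ for all integers $n\ge0$. For $k\ge0$, let $B_k(x)=\dfrac{\prod_{j=1}^k([j]_q+q^jx)}{[k]!_q}$ (so $B_0=1$). -}

module Defs where

open import Data.Nat using (ℕ; zero; suc)
open import Data.Integer using (ℤ; 0ℤ; 1ℤ) renaming (_+_ to _+ℤ_; _*_ to _*ℤ_; -_ to -ℤ_)
open import Data.List using (List; []; _∷_; map; replicate; _++_)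
open import Data.List.Relation.Unary.All using (All)
open import Data.Product using (Σ)
open import Relation.Binary.PropositionalEquality using (_≡_)
open import Relation.Nullary using (¬_)

-- Z[q] : integer polynomials in q as coefficient lists (lowest degree
-- first); equality is "difference is the zero list" (trailing zeros ok).

ZPoly : Set
ZPoly = List ℤ

addP : ZPoly → ZPoly → ZPoly
addP [] p = p
addP (a ∷ p) [] = a ∷ p
addP (a ∷ p) (b ∷ r) = (a +ℤ b) ∷ addP p r

negP : ZPoly → ZPoly
negP = map -ℤ_

scaleP : ℤ → ZPoly → ZPoly
scaleP a = map (a *ℤ_)

mulP : ZPoly → ZPoly → ZPoly
mulP [] r = []
mulP (a ∷ p) r = addP (scaleP a r) (0ℤ ∷ mulP p r)

IsZeroP : ZPoly → Set
IsZeroP = All (_≡ 0ℤ)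

_≈ᶻ_ : ZPoly → ZPoly → Set
p ≈ᶻ r = IsZeroP (addP p (negP r))

qmono : ℕ → ZPoly
qmono m = replicate m 0ℤ ++ (1ℤ ∷ [])

qint : ℕ → ZPoly
qint n = replicate n 1ℤ

qfact : ℕ → ZPoly
qfact zero = 1ℤ ∷ []
qfact (suc k) = mulP (qint (suc k)) (qfact k)

-- Q(q) = Frac(Z[q]) : fractions num/den; well-formedness (den ≠ 0) is a
-- separate predicate.

record RatFun : Set where
  constructor _/_
  field
    num : ZPoly
    den : ZPoly
open RatFun public

_≈ʳ_ : RatFun → RatFun → Set
r ≈ʳ s = mulP (num r) (den s) ≈ᶻ mulP (num s) (den r)

0r 1r : RatFun
0r = [] / (1ℤ ∷ [])
1r = (1ℤ ∷ []) / (1ℤ ∷ [])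

_+ʳ_ : RatFun → RatFun → RatFun
r +ʳ s = addP (mulP (num r) (den s)) (mulP (num s) (den r)) / mulP (den r) (den s)

_*ʳ_ : RatFun → RatFun → RatFun
r *ʳ s = mulP (num r) (num s) / mulP (den r) (den s)

-ʳ_ : RatFun → RatFun
-ʳ r = negP (num r) / den r

fromZ : ZPoly → RatFun
fromZ p = p / (1ℤ ∷ [])

WFʳ : RatFun → Set
WFʳ r = ¬ IsZeroP (den r)

-- Z[q,q^{-1}] : Laurent polynomials  poly / q^shift

record Laurent : Set where
  constructor laurent
  field
    poly  : ZPoly
    shift : ℕ
open Laurent public

toRat : Laurent → RatFun
toRat L = poly L / qmono (shift L)

InLaurent : RatFun → Set
InLaurent r = Σ Laurent (λ L → toRat L ≈ʳ r)

-- Q(q)[x] : coefficient lists over Q(q), lowest degree first.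

PolyX : Set
PolyX = List RatFun

addX : PolyX → PolyX → PolyX
addX [] p = p
addX (a ∷ p) [] = a ∷ p
addX (a ∷ p) (b ∷ r) = (a +ʳ b) ∷ addX p r

negX : PolyX → PolyX
negX = map -ʳ_

scaleX : RatFun → PolyX → PolyX
scaleX a = map (a *ʳ_)

mulX : PolyX → PolyX → PolyX
mulX [] r = []
mulX (a ∷ p) r = addX (scaleX a r) (0r ∷ mulX p r)

_≈ₓ_ : PolyX → PolyX → Set
p ≈ₓ r = All (λ c → IsZeroP (num c)) (addX p (negX r))

WFX : PolyX → Set
WFX = All WFʳ

evalX : PolyX → RatFun → RatFun
evalX [] r = 0r
evalX (a ∷ p) r = a +ʳ (r *ʳ evalX p r)

InA : PolyX → Set
InA P = (n : ℕ) → InLaurent (evalX P (fromZ (qint n)))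

linFactor : ℕ → PolyX
linFactor j = fromZ (qint j) ∷ fromZ (qmono j) ∷ []

prodB : ℕ → PolyX
prodB zero = 1r ∷ []
prodB (suc k) = mulX (prodB k) (linFactor (suc k))

B : ℕ → PolyX
B k = scaleX ((1ℤ ∷ []) / qfact k) (prodB k)

sumB : ℕ → (ℕ → Laurent) → PolyX
sumB zero c = []
sumB (suc N) c = addX (sumB N c) (scaleX (toRat (c N)) (B N))

-- B_k([n]_q) is the Gaussian binomial [n+k choose k]_q, a polynomial in q, so B_k ∈ A_q.
-- B_k has degree k and a nonzero leading coefficient, so the B_k are independent and
-- every P ∈ ℚ(q)[x] is a combination Σ a_k B_k over ℚ(q), found by peeling off leading
-- terms. If moreover P ∈ A_q, the values F(n) = P([n]_q) = Σ a_k [n+k choose k]_q are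
-- Laurent polynomials. By the q-Pascal rule F(n+1) − F(n) = q^(n+1) Σ a_(k+1) [n+1+k choose k]_q,
-- so d forward differences, each divided by a power of q, leave the top coefficient
-- a_d alone; it is therefore a Laurent polynomial, and subtracting a_d B_d gives the
-- remaining coefficients by induction.

module Submission where

open import Defs
open import Algebra.Bundles using (CommutativeRing)
open import Data.Empty using (⊥-elim)
open import Data.Integer using (ℤ; 0ℤ; 1ℤ) renaming (_+_ to _+ℤ_; _*_ to _*ℤ_; -_ to -ℤ_)
import Data.Integer as ℤ
import Data.Integer.Properties as ℤ
open import Data.Integer.Tactic.RingSolver using () renaming (solve-∀ to solve-∀ℤ)
open import Data.List using (List; []; _∷_; length; map)
open import Data.List.Relation.Unary.All using (All; []; _∷_)
open import Data.Maybe using (Maybe; just; nothing)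
open import Data.Nat using (ℕ; zero; suc; _+_; _<_; _≤_; s≤s; z≤n; _<?_)
import Data.Nat.Properties as ℕ
open import Data.Product using (Σ; _×_; _,_; proj₁; proj₂)
open import Data.Sum using (_⊎_; inj₁; inj₂; [_,_]′)
open import Level using (0ℓ)
open import Relation.Binary.PropositionalEquality
  using (_≡_; refl; sym; trans; cong; cong₂; subst; subst₂)
import Relation.Binary.Reasoning.Setoid as SetoidReasoning
open import Relation.Nullary using (¬_; Dec; yes; no)
import Tactic.RingSolver.Core.AlmostCommutativeRing as ACR
import Algebra.Properties.Group as GroupProperties
open import Tactic.RingSolver using (solve-∀)

-- * The ring ℤ[q]

infixl 6 _+ᶻ_
infixl 7 _*ᶻ_

_+ᶻ_ : ZPoly → ZPoly → ZPoly
_+ᶻ_ = addP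

_*ᶻ_ : ZPoly → ZPoly → ZPoly
_*ᶻ_ = mulP

1ᶻ : ZPoly
1ᶻ = 1ℤ ∷ []

coeff : ZPoly → ℕ → ℤ
coeff []      i       = 0ℤ
coeff (a ∷ p) zero    = a
coeff (a ∷ p) (suc i) = coeff p i

-- Coefficientwise equality; a record so that it is never unfolded, which
-- the ring solver relies on.
infix 4 _≃_
record _≃_ (p r : ZPoly) : Set where
  constructor mk≃
  field coeff-≡ : ∀ i → coeff p i ≡ coeff r i
open _≃_

≃-refl : ∀ {p} → p ≃ p
≃-refl = mk≃ λ i → refl

≃-sym : ∀ {p r} → p ≃ r → r ≃ p
≃-sym e = mk≃ λ i → sym (coeff-≡ e i)

≃-trans : ∀ {p r s} → p ≃ r → r ≃ s → p ≃ s
≃-trans e f = mk≃ λ i → trans (coeff-≡ e i) (coeff-≡ f i)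

∷-cong : ∀ {a b p r} → a ≡ b → p ≃ r → a ∷ p ≃ b ∷ r
∷-cong a≡b p≃r = mk≃ λ { zero → a≡b ; (suc i) → coeff-≡ p≃r i }

∷-injective : ∀ {a b p r} → a ∷ p ≃ b ∷ r → a ≡ b × p ≃ r
∷-injective e = coeff-≡ e zero , mk≃ λ i → coeff-≡ e (suc i)

∷≃[]⇒ : ∀ {a p} → a ∷ p ≃ [] → a ≡ 0ℤ × p ≃ []
∷≃[]⇒ e = coeff-≡ e zero , mk≃ λ i → coeff-≡ e (suc i)

∷≃[] : ∀ {a p} → a ≡ 0ℤ → p ≃ [] → a ∷ p ≃ []
∷≃[] a≡0 p≃0 = mk≃ λ { zero → a≡0 ; (suc i) → coeff-≡ p≃0 i }

IsZeroP⇒≃[] : ∀ {p} → IsZeroP p → p ≃ []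
IsZeroP⇒≃[] z = mk≃ (go z)
  where
  go : ∀ {p} → IsZeroP p → ∀ i → coeff p i ≡ 0ℤ
  go []       i       = refl
  go (a≡0 ∷ z) zero    = a≡0
  go (a≡0 ∷ z) (suc i) = go z i

≃[]⇒IsZeroP : ∀ {p} → p ≃ [] → IsZeroP p
≃[]⇒IsZeroP {[]}    e = []
≃[]⇒IsZeroP {a ∷ p} e = proj₁ (∷≃[]⇒ e) ∷ ≃[]⇒IsZeroP (proj₂ (∷≃[]⇒ e))

coeff-addP : ∀ p r i → coeff (addP p r) i ≡ coeff p i +ℤ coeff r i
coeff-addP []      r       i       = sym (ℤ.+-identityˡ _)
coeff-addP (a ∷ p) []      zero    = sym (ℤ.+-identityʳ a)
coeff-addP (a ∷ p) []      (suc i) = sym (ℤ.+-identityʳ _)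
coeff-addP (a ∷ p) (b ∷ r) zero    = refl
coeff-addP (a ∷ p) (b ∷ r) (suc i) = coeff-addP p r i

coeff-negP : ∀ p i → coeff (negP p) i ≡ -ℤ coeff p i
coeff-negP []      i       = refl
coeff-negP (a ∷ p) zero    = refl
coeff-negP (a ∷ p) (suc i) = coeff-negP p i

coeff-scaleP : ∀ a p i → coeff (scaleP a p) i ≡ a *ℤ coeff p i
coeff-scaleP a []      i       = sym (ℤ.*-zeroʳ a)
coeff-scaleP a (b ∷ p) zero    = refl
coeff-scaleP a (b ∷ p) (suc i) = coeff-scaleP a p i

coeff-mulP-∷ : ∀ a p r i → coeff (mulP (a ∷ p) r) i ≡ a *ℤ coeff r i +ℤ coeff (0ℤ ∷ mulP p r) i
coeff-mulP-∷ a p r i =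
  trans (coeff-addP (scaleP a r) _ i) (cong (_+ℤ _) (coeff-scaleP a r i))

coeff-subP : ∀ p r i → coeff (addP p (negP r)) i ≡ coeff p i ℤ.- coeff r i
coeff-subP p r i = trans (coeff-addP p (negP r) i) (cong (coeff p i +ℤ_) (coeff-negP r i))

≈ᶻ⇒≃ : ∀ {p r} → p ≈ᶻ r → p ≃ r
≈ᶻ⇒≃ {p} {r} z = mk≃ λ i →
  ℤ.i-j≡0⇒i≡j _ _ (trans (sym (coeff-subP p r i)) (coeff-≡ (IsZeroP⇒≃[] z) i))

≃⇒≈ᶻ : ∀ {p r} → p ≃ r → p ≈ᶻ r
≃⇒≈ᶻ {p} {r} e = ≃[]⇒IsZeroP (mk≃ λ i → trans (coeff-subP p r i) (ℤ.i≡j⇒i-j≡0 (coeff-≡ e i)))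

addP-cong : ∀ {p p′ r r′} → p ≃ p′ → r ≃ r′ → addP p r ≃ addP p′ r′
addP-cong {p} {p′} {r} {r′} e f = mk≃ λ i →
  trans (coeff-addP p r i) (trans (cong₂ _+ℤ_ (coeff-≡ e i) (coeff-≡ f i)) (sym (coeff-addP p′ r′ i)))

negP-cong : ∀ {p p′} → p ≃ p′ → negP p ≃ negP p′
negP-cong {p} {p′} e = mk≃ λ i →
  trans (coeff-negP p i) (trans (cong -ℤ_ (coeff-≡ e i)) (sym (coeff-negP p′ i)))

scaleP-cong : ∀ {a b p p′} → a ≡ b → p ≃ p′ → scaleP a p ≃ scaleP b p′
scaleP-cong {a} {b} {p} {p′} a≡b e = mk≃ λ i →
  trans (coeff-scaleP a p i) (trans (cong₂ _*ℤ_ a≡b (coeff-≡ e i)) (sym (coeff-scaleP b p′ i)))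

scaleP-zero : ∀ p → scaleP 0ℤ p ≃ []
scaleP-zero p = mk≃ (coeff-scaleP 0ℤ p)

addP-comm : ∀ p r → addP p r ≃ addP r p
addP-comm p r = mk≃ λ i →
  trans (coeff-addP p r i) (trans (ℤ.+-comm (coeff p i) _) (sym (coeff-addP r p i)))

addP-assoc : ∀ p r s → addP (addP p r) s ≃ addP p (addP r s)
addP-assoc p r s = mk≃ λ i → begin
  coeff (addP (addP p r) s) i             ≡⟨ coeff-addP (addP p r) s i ⟩
  coeff (addP p r) i +ℤ coeff s i         ≡⟨ cong (_+ℤ coeff s i) (coeff-addP p r i) ⟩
  coeff p i +ℤ coeff r i +ℤ coeff s i     ≡⟨ ℤ.+-assoc (coeff p i) _ _ ⟩
  coeff p i +ℤ (coeff r i +ℤ coeff s i)   ≡⟨ cong (coeff p i +ℤ_) (coeff-addP r s i) ⟨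
  coeff p i +ℤ coeff (addP r s) i         ≡⟨ coeff-addP p (addP r s) i ⟨
  coeff (addP p (addP r s)) i             ∎
  where open Relation.Binary.PropositionalEquality.≡-Reasoning

addP-identityʳ : ∀ p → addP p [] ≃ p
addP-identityʳ []      = ≃-refl
addP-identityʳ (a ∷ p) = ≃-refl

addP-inverseˡ : ∀ p → addP (negP p) p ≃ []
addP-inverseˡ p = mk≃ λ i →
  trans (coeff-addP (negP p) p i) (trans (cong (_+ℤ coeff p i) (coeff-negP p i)) (ℤ.+-inverseˡ (coeff p i)))

addP-inverseʳ : ∀ p → addP p (negP p) ≃ []
addP-inverseʳ p = ≃-trans (addP-comm p (negP p)) (addP-inverseˡ p)

mulP-zeroˡ : ∀ {p} r → p ≃ [] → mulP p r ≃ []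
mulP-zeroˡ {[]}    r e = ≃-refl
mulP-zeroˡ {a ∷ p} r e with ∷≃[]⇒ e
... | a≡0 , p≃0 = addP-cong (≃-trans (scaleP-cong a≡0 ≃-refl) (scaleP-zero r)) (∷≃[] refl (mulP-zeroˡ r p≃0))

mulP-zeroʳ : ∀ p → mulP p [] ≃ []
mulP-zeroʳ []      = ≃-refl
mulP-zeroʳ (a ∷ p) = ∷≃[] refl (mulP-zeroʳ p)

mulP-congˡ : ∀ {p p′} r → p ≃ p′ → mulP p r ≃ mulP p′ r
mulP-congˡ {[]}    {p′}     r e = ≃-sym (mulP-zeroˡ r (≃-sym e))
mulP-congˡ {a ∷ p} {[]}     r e = mulP-zeroˡ r e
mulP-congˡ {a ∷ p} {a′ ∷ p′} r e with ∷-injective e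
... | a≡a′ , p≃p′ = addP-cong (scaleP-cong a≡a′ ≃-refl) (∷-cong refl (mulP-congˡ r p≃p′))

mulP-congʳ : ∀ p {r r′} → r ≃ r′ → mulP p r ≃ mulP p r′
mulP-congʳ []      e = ≃-refl
mulP-congʳ (a ∷ p) e = addP-cong (scaleP-cong {a} refl e) (∷-cong refl (mulP-congʳ p e))

mulP-cong : ∀ {p p′ r r′} → p ≃ p′ → r ≃ r′ → mulP p r ≃ mulP p′ r′
mulP-cong {p′ = p′} {r = r} e f = ≃-trans (mulP-congˡ r e) (mulP-congʳ p′ f)

mulP-shiftˡ : ∀ p r → mulP (0ℤ ∷ p) r ≃ 0ℤ ∷ mulP p r
mulP-shiftˡ p r = addP-cong (scaleP-zero r) ≃-refl

mulP-∷ʳ : ∀ p b r → mulP p (b ∷ r) ≃ addP (scaleP b p) (0ℤ ∷ mulP p r)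
mulP-∷ʳ []      b r = mk≃ λ { zero → refl ; (suc i) → refl }
mulP-∷ʳ (a ∷ p) b r = mk≃ λ
  { zero → trans (ℤ.+-identityʳ (a *ℤ b)) (trans (ℤ.*-comm a b) (sym (ℤ.+-identityʳ (b *ℤ a))))
  ; (suc i) → begin
      coeff (mulP (a ∷ p) (b ∷ r)) (suc i)
        ≡⟨ coeff-mulP-∷ a p (b ∷ r) (suc i) ⟩
      a *ℤ coeff r i +ℤ coeff (mulP p (b ∷ r)) i
        ≡⟨ cong (a *ℤ coeff r i +ℤ_) (coeff-≡ (mulP-∷ʳ p b r) i) ⟩
      a *ℤ coeff r i +ℤ coeff (addP (scaleP b p) (0ℤ ∷ mulP p r)) i
        ≡⟨ cong (a *ℤ coeff r i +ℤ_) (trans (coeff-addP (scaleP b p) _ i) (cong (_+ℤ _) (coeff-scaleP b p i))) ⟩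
      a *ℤ coeff r i +ℤ (b *ℤ coeff p i +ℤ coeff (0ℤ ∷ mulP p r) i)
        ≡⟨ swap (a *ℤ coeff r i) (b *ℤ coeff p i) _ ⟩
      b *ℤ coeff p i +ℤ (a *ℤ coeff r i +ℤ coeff (0ℤ ∷ mulP p r) i)
        ≡⟨ cong₂ _+ℤ_ (coeff-scaleP b p i) (coeff-mulP-∷ a p r i) ⟨
      coeff (scaleP b p) i +ℤ coeff (mulP (a ∷ p) r) i
        ≡⟨ coeff-addP (scaleP b (a ∷ p)) (0ℤ ∷ mulP (a ∷ p) r) (suc i) ⟨
      coeff (addP (scaleP b (a ∷ p)) (0ℤ ∷ mulP (a ∷ p) r)) (suc i) ∎ }
  where
  open Relation.Binary.PropositionalEquality.≡-Reasoning
  swap : ∀ x y z → x +ℤ (y +ℤ z) ≡ y +ℤ (x +ℤ z)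
  swap = solve-∀ℤ

mulP-comm : ∀ p r → mulP p r ≃ mulP r p
mulP-comm []      r = ≃-sym (mulP-zeroʳ r)
mulP-comm (a ∷ p) r = ≃-trans (addP-cong ≃-refl (∷-cong refl (mulP-comm p r))) (≃-sym (mulP-∷ʳ r a p))

mulP-distribʳ : ∀ p r s → mulP (addP p r) s ≃ addP (mulP p s) (mulP r s)
mulP-distribʳ []      r       s = ≃-refl
mulP-distribʳ (a ∷ p) []      s = ≃-sym (addP-identityʳ (mulP (a ∷ p) s))
mulP-distribʳ (a ∷ p) (b ∷ r) s = mk≃ λ i → begin
  coeff (mulP ((a +ℤ b) ∷ addP p r) s) i
    ≡⟨ coeff-mulP-∷ (a +ℤ b) (addP p r) s i ⟩
  (a +ℤ b) *ℤ coeff s i +ℤ coeff (0ℤ ∷ mulP (addP p r) s) i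
    ≡⟨ cong₂ _+ℤ_ (ℤ.*-distribʳ-+ (coeff s i) a b) (coeff-≡ (∷-cong (sym (ℤ.+-identityʳ 0ℤ)) (mulP-distribʳ p r s)) i) ⟩
  a *ℤ coeff s i +ℤ b *ℤ coeff s i +ℤ coeff (addP (0ℤ ∷ mulP p s) (0ℤ ∷ mulP r s)) i
    ≡⟨ cong (a *ℤ coeff s i +ℤ b *ℤ coeff s i +ℤ_) (coeff-addP (0ℤ ∷ mulP p s) (0ℤ ∷ mulP r s) i) ⟩
  a *ℤ coeff s i +ℤ b *ℤ coeff s i +ℤ (coeff (0ℤ ∷ mulP p s) i +ℤ coeff (0ℤ ∷ mulP r s) i)
    ≡⟨ interchange (a *ℤ coeff s i) (b *ℤ coeff s i) _ _ ⟩
  a *ℤ coeff s i +ℤ coeff (0ℤ ∷ mulP p s) i +ℤ (b *ℤ coeff s i +ℤ coeff (0ℤ ∷ mulP r s) i)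
    ≡⟨ cong₂ _+ℤ_ (coeff-mulP-∷ a p s i) (coeff-mulP-∷ b r s i) ⟨
  coeff (mulP (a ∷ p) s) i +ℤ coeff (mulP (b ∷ r) s) i
    ≡⟨ coeff-addP (mulP (a ∷ p) s) (mulP (b ∷ r) s) i ⟨
  coeff (addP (mulP (a ∷ p) s) (mulP (b ∷ r) s)) i ∎
  where
  open Relation.Binary.PropositionalEquality.≡-Reasoning
  interchange : ∀ x y z w → x +ℤ y +ℤ (z +ℤ w) ≡ x +ℤ z +ℤ (y +ℤ w)
  interchange = solve-∀ℤ

mulP-distribˡ : ∀ p r s → mulP p (addP r s) ≃ addP (mulP p r) (mulP p s)
mulP-distribˡ p r s =
  ≃-trans (mulP-comm p (addP r s))
    (≃-trans (mulP-distribʳ r s p) (addP-cong (mulP-comm r p) (mulP-comm s p)))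

mulP-scaleˡ : ∀ a p s → mulP (scaleP a p) s ≃ scaleP a (mulP p s)
mulP-scaleˡ a []      s = ≃-refl
mulP-scaleˡ a (b ∷ p) s = mk≃ λ i → begin
  coeff (mulP ((a *ℤ b) ∷ scaleP a p) s) i
    ≡⟨ coeff-mulP-∷ (a *ℤ b) (scaleP a p) s i ⟩
  a *ℤ b *ℤ coeff s i +ℤ coeff (0ℤ ∷ mulP (scaleP a p) s) i
    ≡⟨ cong₂ _+ℤ_ (ℤ.*-assoc a b (coeff s i)) (coeff-≡ (∷-cong (sym (ℤ.*-zeroʳ a)) (mulP-scaleˡ a p s)) i) ⟩
  a *ℤ (b *ℤ coeff s i) +ℤ coeff (scaleP a (0ℤ ∷ mulP p s)) i
    ≡⟨ cong (a *ℤ (b *ℤ coeff s i) +ℤ_) (coeff-scaleP a (0ℤ ∷ mulP p s) i) ⟩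
  a *ℤ (b *ℤ coeff s i) +ℤ a *ℤ coeff (0ℤ ∷ mulP p s) i
    ≡⟨ ℤ.*-distribˡ-+ a _ _ ⟨
  a *ℤ (b *ℤ coeff s i +ℤ coeff (0ℤ ∷ mulP p s) i)
    ≡⟨ cong (a *ℤ_) (coeff-mulP-∷ b p s i) ⟨
  a *ℤ coeff (mulP (b ∷ p) s) i
    ≡⟨ coeff-scaleP a (mulP (b ∷ p) s) i ⟨
  coeff (scaleP a (mulP (b ∷ p) s)) i ∎
  where open Relation.Binary.PropositionalEquality.≡-Reasoning

mulP-assoc : ∀ p r s → mulP (mulP p r) s ≃ mulP p (mulP r s)
mulP-assoc []      r s = ≃-refl
mulP-assoc (a ∷ p) r s =
  ≃-trans (mulP-distribʳ (scaleP a r) (0ℤ ∷ mulP p r) s)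
    (addP-cong (mulP-scaleˡ a r s) (≃-trans (mulP-shiftˡ (mulP p r) s) (∷-cong refl (mulP-assoc p r s))))

mulP-identityˡ : ∀ r → mulP 1ᶻ r ≃ r
mulP-identityˡ r = mk≃ λ i →
  trans (coeff-mulP-∷ 1ℤ [] r i) (trans (cong₂ _+ℤ_ (ℤ.*-identityˡ (coeff r i)) (zero-coeff i)) (ℤ.+-identityʳ _))
  where
  zero-coeff : ∀ i → coeff (0ℤ ∷ []) i ≡ 0ℤ
  zero-coeff zero    = refl
  zero-coeff (suc i) = refl

ℤ[q] : CommutativeRing 0ℓ 0ℓ
ℤ[q] = record
  { Carrier = ZPoly ; _≈_ = _≃_ ; _+_ = addP ; _*_ = mulP ; -_ = negP ; 0# = [] ; 1# = 1ᶻ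
  ; isCommutativeRing = record
    { isRing = record
      { +-isAbelianGroup = record
        { isGroup = record
          { isMonoid = record
            { isSemigroup = record
              { isMagma = record
                { isEquivalence = record { refl = ≃-refl ; sym = ≃-sym ; trans = ≃-trans }
                ; ∙-cong = addP-cong }
              ; assoc = addP-assoc }
            ; identity = (λ p → ≃-refl) , addP-identityʳ }
          ; inverse = addP-inverseˡ , addP-inverseʳ
          ; ⁻¹-cong = negP-cong }
        ; comm = addP-comm }
      ; *-cong = mulP-cong
      ; *-assoc = mulP-assoc
      ; *-identity = mulP-identityˡ , λ r → ≃-trans (mulP-comm r _) (mulP-identityˡ r)
      ; distrib = mulP-distribˡ , λ p r s → mulP-distribʳ r s p }
    ; *-comm = mulP-comm } }

module ℤ[q]-Reasoning = SetoidReasoning (CommutativeRing.setoid ℤ[q])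

≃[]? : ∀ p → Dec (p ≃ [])
≃[]? []      = yes ≃-refl
≃[]? (a ∷ p) with a ℤ.≟ 0ℤ | ≃[]? p
... | yes a≡0 | yes p≃0 = yes (∷≃[] a≡0 p≃0)
... | no  a≢0 | _       = no λ e → a≢0 (proj₁ (∷≃[]⇒ e))
... | yes _   | no  p≄0 = no λ e → p≄0 (proj₂ (∷≃[]⇒ e))

ℤ[q]-solvable : ACR.AlmostCommutativeRing 0ℓ 0ℓ
ℤ[q]-solvable = ACR.fromCommutativeRing ℤ[q] is-zero?
  where
  is-zero? : ∀ p → Maybe ([] ≃ p)
  is-zero? p with ≃[]? p
  ... | yes p≃0 = just (≃-sym p≃0)
  ... | no _    = nothing

≄[]-∷ : ∀ {a p} → ¬ a ≡ 0ℤ → ¬ a ∷ p ≃ []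
≄[]-∷ a≢0 e = a≢0 (proj₁ (∷≃[]⇒ e))

-- With a ≠ 0 the constant term of (a ∷ p)(b ∷ r) forces b = 0, and then q divides both sides.
mulP-leading-cancel : ∀ {a} p r → ¬ a ≡ 0ℤ → mulP (a ∷ p) r ≃ [] → r ≃ []
mulP-leading-cancel {a} p []      a≢0 e = ≃-refl
mulP-leading-cancel {a} p (b ∷ r) a≢0 e
  with ℤ.i*j≡0⇒i≡0∨j≡0 a (trans (sym (ℤ.+-identityʳ (a *ℤ b))) (proj₁ (∷≃[]⇒ e)))
... | inj₁ a≡0 = ⊥-elim (a≢0 a≡0)
... | inj₂ b≡0 = ∷≃[] b≡0 (mulP-leading-cancel p r a≢0 (proj₂ (∷≃[]⇒ shifted)))
  where
  shifted : 0ℤ ∷ mulP (a ∷ p) r ≃ []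
  shifted = ≃-trans (≃-sym (≃-trans (mulP-∷ʳ (a ∷ p) 0ℤ r) (addP-cong (scaleP-zero (a ∷ p)) ≃-refl)))
              (≃-trans (mulP-congʳ (a ∷ p) (∷-cong (sym b≡0) ≃-refl)) e)

mulP-zero-head : ∀ {a} p r → a ≡ 0ℤ → mulP (a ∷ p) r ≃ 0ℤ ∷ mulP p r
mulP-zero-head p r a≡0 = ≃-trans (mulP-congˡ r (∷-cong a≡0 (≃-refl {p}))) (mulP-shiftˡ p r)

mulP≃[]⇒ : ∀ p r → mulP p r ≃ [] → p ≃ [] ⊎ r ≃ []
mulP≃[]⇒ []      r e = inj₁ ≃-refl
mulP≃[]⇒ (a ∷ p) r e with a ℤ.≟ 0ℤ
... | no  a≢0 = inj₂ (mulP-leading-cancel p r a≢0 e)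
... | yes a≡0 with mulP≃[]⇒ p r (proj₂ (∷≃[]⇒ (≃-trans (≃-sym (mulP-zero-head p r a≡0)) e)))
...   | inj₁ p≃0 = inj₁ (∷≃[] a≡0 p≃0)
...   | inj₂ r≃0 = inj₂ r≃0

≄[]-mulP : ∀ {p r} → ¬ p ≃ [] → ¬ r ≃ [] → ¬ mulP p r ≃ []
≄[]-mulP {p} {r} p≄0 r≄0 e with mulP≃[]⇒ p r e
... | inj₁ p≃0 = p≄0 p≃0
... | inj₂ r≃0 = r≄0 r≃0

≄[]-1 : ¬ 1ᶻ ≃ []
≄[]-1 = ≄[]-∷ (λ ())

≄[]-qmono : ∀ m → ¬ qmono m ≃ []
≄[]-qmono zero    = ≄[]-1
≄[]-qmono (suc m) e = ≄[]-qmono m (proj₂ (∷≃[]⇒ e))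

≄[]-qint : ∀ k → ¬ qint (suc k) ≃ []
≄[]-qint k = ≄[]-∷ (λ ())

≄[]-qfact : ∀ k → ¬ qfact k ≃ []
≄[]-qfact zero    = ≄[]-1
≄[]-qfact (suc k) = ≄[]-mulP (≄[]-qint k) (≄[]-qfact k)

mulP-cancelʳ : ∀ {x y e} → ¬ e ≃ [] → x *ᶻ e ≃ y *ᶻ e → x ≃ y
mulP-cancelʳ {x} {y} {e} e≄0 xe≃ye =
  [ (λ x-y≃0 → ≃-trans (reassoc x y) (addP-cong x-y≃0 ≃-refl)) , (λ e≃0 → ⊥-elim (e≄0 e≃0)) ]′
    (mulP≃[]⇒ (x +ᶻ negP y) e (≃-trans (distrib x y e) (≃-trans (addP-cong xe≃ye ≃-refl) (addP-inverseʳ (y *ᶻ e)))))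
  where
  distrib : ∀ x y e → (x +ᶻ negP y) *ᶻ e ≃ x *ᶻ e +ᶻ negP (y *ᶻ e)
  distrib = solve-∀ ℤ[q]-solvable
  reassoc : ∀ x y → x ≃ x +ᶻ negP y +ᶻ y
  reassoc = solve-∀ ℤ[q]-solvable

-- * The field of fractions ℚ(q)

-- ≈ʳ is not transitive on all of RatFun (a zero denominator makes a fraction
-- equivalent to everything), so ℚ(q) is the setoid of well-formed fractions.
record Frac : Set where
  constructor frac
  field
    val : RatFun
    wf  : WFʳ val
open Frac

den≄[] : (r : Frac) → ¬ den (val r) ≃ []
den≄[] r d≃0 = wf r (≃[]⇒IsZeroP d≃0)

infix 4 _≈_
record _≈_ (r s : Frac) : Set where
  constructor mk≈
  field cross : num (val r) *ᶻ den (val s) ≃ num (val s) *ᶻ den (val r)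
open _≈_

≈-parts : ∀ {r s} → num (val r) ≃ num (val s) → den (val r) ≃ den (val s) → r ≈ s
≈-parts num≃ den≃ = mk≈ (mulP-cong num≃ (≃-sym den≃))

≈⇒≈ʳ : ∀ {r s} → r ≈ s → val r ≈ʳ val s
≈⇒≈ʳ r≈s = ≃⇒≈ᶻ (cross r≈s)

≈ʳ⇒≈ : ∀ {r s} → val r ≈ʳ val s → r ≈ s
≈ʳ⇒≈ e = mk≈ (≈ᶻ⇒≃ e)

wf-mulP : ∀ r s → ¬ IsZeroP (den (val r) *ᶻ den (val s))
wf-mulP r s z = ≄[]-mulP (den≄[] r) (den≄[] s) (IsZeroP⇒≃[] z)

infixl 6 _+Q_
infixl 7 _*Q_
infix  8 -Q_

_+Q_ : Frac → Frac → Frac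
r +Q s = frac (val r +ʳ val s) (wf-mulP r s)

_*Q_ : Frac → Frac → Frac
r *Q s = frac (val r *ʳ val s) (wf-mulP r s)

-Q_ : Frac → Frac
-Q r = frac (-ʳ val r) (wf r)

fromZP : ZPoly → Frac
fromZP p = frac (fromZ p) (λ z → ≄[]-1 (IsZeroP⇒≃[] z))

0Q 1Q : Frac
0Q = fromZP []
1Q = fromZP 1ᶻ

≈-refl : ∀ {r} → r ≈ r
≈-refl = mk≈ ≃-refl

≡⇒≈ : ∀ {r s} → r ≡ s → r ≈ s
≡⇒≈ refl = ≈-refl

≈-sym : ∀ {r s} → r ≈ s → s ≈ r
≈-sym (mk≈ e) = mk≈ (≃-sym e)

≈-trans : ∀ {r s t} → r ≈ s → s ≈ t → r ≈ t
≈-trans {frac (a / d) _} {s@(frac (b / e) _)} {frac (c / f) _} (mk≈ ae≃bd) (mk≈ bf≃ce) =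
  mk≈ (mulP-cancelʳ (den≄[] s) (begin
    a *ᶻ f *ᶻ e   ≈⟨ swap a f e ⟩
    a *ᶻ e *ᶻ f   ≈⟨ mulP-congˡ f ae≃bd ⟩
    b *ᶻ d *ᶻ f   ≈⟨ swap b d f ⟩
    b *ᶻ f *ᶻ d   ≈⟨ mulP-congˡ d bf≃ce ⟩
    c *ᶻ e *ᶻ d   ≈⟨ swap c e d ⟩
    c *ᶻ d *ᶻ e   ∎))
  where
  open ℤ[q]-Reasoning
  swap : ∀ x y z → x *ᶻ y *ᶻ z ≃ x *ᶻ z *ᶻ y
  swap = solve-∀ ℤ[q]-solvable

+Q-cong : ∀ {r r′ s s′} → r ≈ r′ → s ≈ s′ → r +Q s ≈ r′ +Q s′
+Q-cong {frac (a / d) _} {frac (a′ / d′) _} {frac (b / e) _} {frac (b′ / e′) _} (mk≈ r≈r′) (mk≈ s≈s′) =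
  mk≈ (begin
    (a *ᶻ e +ᶻ b *ᶻ d) *ᶻ (d′ *ᶻ e′)             ≈⟨ expand a b d e d′ e′ ⟩
    a *ᶻ d′ *ᶻ (e *ᶻ e′) +ᶻ b *ᶻ e′ *ᶻ (d *ᶻ d′)  ≈⟨ addP-cong (mulP-congˡ _ r≈r′) (mulP-congˡ _ s≈s′) ⟩
    a′ *ᶻ d *ᶻ (e *ᶻ e′) +ᶻ b′ *ᶻ e *ᶻ (d *ᶻ d′)  ≈⟨ collect a′ b′ d e d′ e′ ⟩
    (a′ *ᶻ e′ +ᶻ b′ *ᶻ d′) *ᶻ (d *ᶻ e)           ∎)
  where
  open ℤ[q]-Reasoning
  expand : ∀ a b d e d′ e′ → (a *ᶻ e +ᶻ b *ᶻ d) *ᶻ (d′ *ᶻ e′) ≃ a *ᶻ d′ *ᶻ (e *ᶻ e′) +ᶻ b *ᶻ e′ *ᶻ (d *ᶻ d′)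
  expand = solve-∀ ℤ[q]-solvable
  collect : ∀ a′ b′ d e d′ e′ → a′ *ᶻ d *ᶻ (e *ᶻ e′) +ᶻ b′ *ᶻ e *ᶻ (d *ᶻ d′) ≃ (a′ *ᶻ e′ +ᶻ b′ *ᶻ d′) *ᶻ (d *ᶻ e)
  collect = solve-∀ ℤ[q]-solvable

*Q-cong : ∀ {r r′ s s′} → r ≈ r′ → s ≈ s′ → r *Q s ≈ r′ *Q s′
*Q-cong {frac (a / d) _} {frac (a′ / d′) _} {frac (b / e) _} {frac (b′ / e′) _} (mk≈ r≈r′) (mk≈ s≈s′) =
  mk≈ (begin
    a *ᶻ b *ᶻ (d′ *ᶻ e′)     ≈⟨ regroup a b d′ e′ ⟩
    a *ᶻ d′ *ᶻ (b *ᶻ e′)     ≈⟨ mulP-cong r≈r′ s≈s′ ⟩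
    a′ *ᶻ d *ᶻ (b′ *ᶻ e)     ≈⟨ regroup a′ b′ d e ⟨
    a′ *ᶻ b′ *ᶻ (d *ᶻ e)     ∎)
  where
  open ℤ[q]-Reasoning
  regroup : ∀ a b d e → a *ᶻ b *ᶻ (d *ᶻ e) ≃ a *ᶻ d *ᶻ (b *ᶻ e)
  regroup = solve-∀ ℤ[q]-solvable

-Q-cong : ∀ {r r′} → r ≈ r′ → -Q r ≈ -Q r′
-Q-cong {frac (a / d) _} {frac (a′ / d′) _} (mk≈ r≈r′) =
  mk≈ (≃-trans (pull a d′) (≃-trans (negP-cong r≈r′) (≃-sym (pull a′ d))))
  where
  pull : ∀ a d → mulP (negP a) d ≃ negP (a *ᶻ d)
  pull = solve-∀ ℤ[q]-solvable

+Q-congˡ : ∀ r {s s′} → s ≈ s′ → r +Q s ≈ r +Q s′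
+Q-congˡ r = +Q-cong (≈-refl {r})

+Q-congʳ : ∀ {r r′} s → r ≈ r′ → r +Q s ≈ r′ +Q s
+Q-congʳ s r≈r′ = +Q-cong r≈r′ (≈-refl {s})

*Q-congˡ : ∀ r {s s′} → s ≈ s′ → r *Q s ≈ r *Q s′
*Q-congˡ r = *Q-cong (≈-refl {r})

*Q-congʳ : ∀ {r r′} s → r ≈ r′ → r *Q s ≈ r′ *Q s
*Q-congʳ s r≈r′ = *Q-cong r≈r′ (≈-refl {s})

+Q-assoc : ∀ r s t → r +Q s +Q t ≈ r +Q (s +Q t)
+Q-assoc (frac (a / d) _) (frac (b / e) _) (frac (c / f) _) = mk≈ (law a b c d e f)
  where
  law : ∀ a b c d e f → ((a *ᶻ e +ᶻ b *ᶻ d) *ᶻ f +ᶻ c *ᶻ (d *ᶻ e)) *ᶻ (d *ᶻ (e *ᶻ f))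
                     ≃ (a *ᶻ (e *ᶻ f) +ᶻ (b *ᶻ f +ᶻ c *ᶻ e) *ᶻ d) *ᶻ (d *ᶻ e *ᶻ f)
  law = solve-∀ ℤ[q]-solvable

+Q-comm : ∀ r s → r +Q s ≈ s +Q r
+Q-comm (frac (a / d) _) (frac (b / e) _) = mk≈ (law a b d e)
  where
  law : ∀ a b d e → (a *ᶻ e +ᶻ b *ᶻ d) *ᶻ (e *ᶻ d) ≃ (b *ᶻ d +ᶻ a *ᶻ e) *ᶻ (d *ᶻ e)
  law = solve-∀ ℤ[q]-solvable

+Q-identityˡ : ∀ r → 0Q +Q r ≈ r
+Q-identityˡ (frac (a / d) _) = mk≈ (law a d)
  where
  law : ∀ a d → ([] *ᶻ d +ᶻ a *ᶻ 1ᶻ) *ᶻ d ≃ a *ᶻ (1ᶻ *ᶻ d)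
  law = solve-∀ ℤ[q]-solvable

+Q-inverseˡ : ∀ r → -Q r +Q r ≈ 0Q
+Q-inverseˡ (frac (a / d) _) = mk≈ (law a d)
  where
  law : ∀ a d → (negP a *ᶻ d +ᶻ a *ᶻ d) *ᶻ 1ᶻ ≃ [] *ᶻ (d *ᶻ d)
  law = solve-∀ ℤ[q]-solvable

*Q-assoc : ∀ r s t → r *Q s *Q t ≈ r *Q (s *Q t)
*Q-assoc (frac (a / d) _) (frac (b / e) _) (frac (c / f) _) = mk≈ (law a b c d e f)
  where
  law : ∀ a b c d e f → a *ᶻ b *ᶻ c *ᶻ (d *ᶻ (e *ᶻ f)) ≃ a *ᶻ (b *ᶻ c) *ᶻ (d *ᶻ e *ᶻ f)
  law = solve-∀ ℤ[q]-solvable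

*Q-comm : ∀ r s → r *Q s ≈ s *Q r
*Q-comm (frac (a / d) _) (frac (b / e) _) = mk≈ (law a b d e)
  where
  law : ∀ a b d e → a *ᶻ b *ᶻ (e *ᶻ d) ≃ b *ᶻ a *ᶻ (d *ᶻ e)
  law = solve-∀ ℤ[q]-solvable

*Q-identityˡ : ∀ r → 1Q *Q r ≈ r
*Q-identityˡ (frac (a / d) _) = mk≈ (law a d)
  where
  law : ∀ a d → 1ᶻ *ᶻ a *ᶻ d ≃ a *ᶻ (1ᶻ *ᶻ d)
  law = solve-∀ ℤ[q]-solvable

*Q-distribʳ : ∀ r s t → (s +Q t) *Q r ≈ s *Q r +Q t *Q r
*Q-distribʳ (frac (a / d) _) (frac (b / e) _) (frac (c / f) _) = mk≈ (law a b c d e f)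
  where
  law : ∀ a b c d e f → (b *ᶻ f +ᶻ c *ᶻ e) *ᶻ a *ᶻ (e *ᶻ d *ᶻ (f *ᶻ d))
                     ≃ (b *ᶻ a *ᶻ (f *ᶻ d) +ᶻ c *ᶻ a *ᶻ (e *ᶻ d)) *ᶻ (e *ᶻ f *ᶻ d)
  law = solve-∀ ℤ[q]-solvable

ℚ[q] : CommutativeRing 0ℓ 0ℓ
ℚ[q] = record
  { Carrier = Frac ; _≈_ = _≈_ ; _+_ = _+Q_ ; _*_ = _*Q_ ; -_ = -Q_ ; 0# = 0Q ; 1# = 1Q
  ; isCommutativeRing = record
    { isRing = record
      { +-isAbelianGroup = record
        { isGroup = record
          { isMonoid = record
            { isSemigroup = record
              { isMagma = record
                { isEquivalence = record { refl = ≈-refl ; sym = ≈-sym ; trans = ≈-trans }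
                ; ∙-cong = +Q-cong }
              ; assoc = +Q-assoc }
            ; identity = +Q-identityˡ , λ r → ≈-trans (+Q-comm r 0Q) (+Q-identityˡ r) }
          ; inverse = +Q-inverseˡ , λ r → ≈-trans (+Q-comm r (-Q r)) (+Q-inverseˡ r)
          ; ⁻¹-cong = -Q-cong }
        ; comm = +Q-comm }
      ; *-cong = *Q-cong
      ; *-assoc = *Q-assoc
      ; *-identity = *Q-identityˡ , λ r → ≈-trans (*Q-comm r 1Q) (*Q-identityˡ r)
      ; distrib = (λ r s t → ≈-trans (*Q-comm r (s +Q t))
                    (≈-trans (*Q-distribʳ r s t) (+Q-cong (*Q-comm s r) (*Q-comm t r))))
                , *Q-distribʳ }
    ; *-comm = *Q-comm } }

open CommutativeRing ℚ[q] public using ()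
  renaming ( +-identityʳ to +Q-identityʳ ; -‿inverseʳ to +Q-inverseʳ
           ; zeroˡ to *Q-zeroˡ ; zeroʳ to *Q-zeroʳ ; distribˡ to *Q-distribˡ )

mulP-identityʳ : ∀ p → p *ᶻ 1ᶻ ≃ p
mulP-identityʳ p = ≃-trans (mulP-comm p 1ᶻ) (mulP-identityˡ p)

≈0Q⇒num≃[] : ∀ {r} → r ≈ 0Q → num (val r) ≃ []
≈0Q⇒num≃[] {r} (mk≈ e) = ≃-trans (≃-sym (mulP-identityʳ (num (val r)))) e

num≃[]⇒≈0Q : ∀ {r} → num (val r) ≃ [] → r ≈ 0Q
num≃[]⇒≈0Q {r} z = mk≈ (≃-trans (mulP-identityʳ (num (val r))) z)

ℚ[q]-solvable : ACR.AlmostCommutativeRing 0ℓ 0ℓ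
ℚ[q]-solvable = ACR.fromCommutativeRing ℚ[q] is-zero?
  where
  is-zero? : ∀ r → Maybe (0Q ≈ r)
  is-zero? r with ≃[]? (num (val r))
  ... | yes z = just (≈-sym (num≃[]⇒≈0Q z))
  ... | no _  = nothing

fromZP-cong : ∀ {p r} → p ≃ r → fromZP p ≈ fromZP r
fromZP-cong e = ≈-parts e ≃-refl

fromZP-+ : ∀ p r → fromZP (p +ᶻ r) ≈ fromZP p +Q fromZP r
fromZP-+ p r = mk≈ (law p r)
  where
  law : ∀ p r → (p +ᶻ r) *ᶻ (1ᶻ *ᶻ 1ᶻ) ≃ (p *ᶻ 1ᶻ +ᶻ r *ᶻ 1ᶻ) *ᶻ 1ᶻ
  law = solve-∀ ℤ[q]-solvable

fromZP-* : ∀ p r → fromZP (p *ᶻ r) ≈ fromZP p *Q fromZP r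
fromZP-* p r = mk≈ (law p r)
  where
  law : ∀ p r → p *ᶻ r *ᶻ (1ᶻ *ᶻ 1ᶻ) ≃ p *ᶻ r *ᶻ 1ᶻ
  law = solve-∀ ℤ[q]-solvable

*Q-zero⇒ : ∀ r s → r *Q s ≈ 0Q → r ≈ 0Q ⊎ s ≈ 0Q
*Q-zero⇒ r s rs≈0 with mulP≃[]⇒ (num (val r)) (num (val s)) (≈0Q⇒num≃[] {r *Q s} rs≈0)
... | inj₁ r≃0 = inj₁ (num≃[]⇒≈0Q r≃0)
... | inj₂ s≃0 = inj₂ (num≃[]⇒≈0Q s≃0)

_÷_⟨_⟩ : (r s : Frac) → ¬ s ≈ 0Q → Frac
r ÷ s ⟨ s≉0 ⟩ = frac ((num (val r) *ᶻ den (val s)) / (den (val r) *ᶻ num (val s)))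
  (λ z → ≄[]-mulP (den≄[] r) (λ s≃0 → s≉0 (num≃[]⇒≈0Q s≃0)) (IsZeroP⇒≃[] z))

÷-*Q : ∀ r s (s≉0 : ¬ s ≈ 0Q) → r ÷ s ⟨ s≉0 ⟩ *Q s ≈ r
÷-*Q (frac (a / d) _) (frac (b / e) _) s≉0 = mk≈ (law a b d e)
  where
  law : ∀ a b d e → a *ᶻ e *ᶻ b *ᶻ d ≃ a *ᶻ (d *ᶻ b *ᶻ e)
  law = solve-∀ ℤ[q]-solvable

-- * The subring ℤ[q, q⁻¹]

toRatQ : Laurent → Frac
toRatQ L = frac (toRat L) (λ z → ≄[]-qmono (shift L) (IsZeroP⇒≃[] z))

IsLaurent : Frac → Set
IsLaurent r = Σ Laurent λ L → toRatQ L ≈ r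

IsLaurent⇒InLaurent : ∀ {r} → IsLaurent r → InLaurent (val r)
IsLaurent⇒InLaurent (L , L≈r) = L , ≈⇒≈ʳ L≈r

InLaurent⇒IsLaurent : ∀ {r} → InLaurent (val r) → IsLaurent r
InLaurent⇒IsLaurent (L , L≈r) = L , ≈ʳ⇒≈ L≈r

IsLaurent-resp : ∀ {r s} → r ≈ s → IsLaurent r → IsLaurent s
IsLaurent-resp r≈s (L , L≈r) = L , ≈-trans L≈r r≈s

qmono-+ : ∀ a b → qmono (a + b) ≃ qmono a *ᶻ qmono b
qmono-+ zero    b = ≃-sym (mulP-identityˡ (qmono b))
qmono-+ (suc a) b = ≃-trans (∷-cong refl (qmono-+ a b)) (≃-sym (mulP-shiftˡ (qmono a) (qmono b)))

IsLaurent-+ : ∀ {r s} → IsLaurent r → IsLaurent s → IsLaurent (r +Q s)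
IsLaurent-+ (laurent p a , L≈r) (laurent p′ b , L′≈s) =
  laurent (p *ᶻ qmono b +ᶻ p′ *ᶻ qmono a) (a + b) ,
  ≈-trans (≈-parts ≃-refl (qmono-+ a b)) (+Q-cong L≈r L′≈s)

IsLaurent-* : ∀ {r s} → IsLaurent r → IsLaurent s → IsLaurent (r *Q s)
IsLaurent-* (laurent p a , L≈r) (laurent p′ b , L′≈s) =
  laurent (p *ᶻ p′) (a + b) , ≈-trans (≈-parts ≃-refl (qmono-+ a b)) (*Q-cong L≈r L′≈s)

IsLaurent-neg : ∀ {r} → IsLaurent r → IsLaurent (-Q r)
IsLaurent-neg (laurent p a , L≈r) = laurent (negP p) a , -Q-cong L≈r

IsLaurent-fromZP : ∀ p → IsLaurent (fromZP p)
IsLaurent-fromZP p = laurent p 0 , ≈-refl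

q⁻ : ℕ → Frac
q⁻ j = toRatQ (laurent 1ᶻ j)

IsLaurent-q⁻ : ∀ j → IsLaurent (q⁻ j)
IsLaurent-q⁻ j = laurent 1ᶻ j , ≈-refl

q⁻-inverse : ∀ j → q⁻ j *Q fromZP (qmono j) ≈ 1Q
q⁻-inverse j = mk≈ (law (qmono j))
  where
  law : ∀ m → 1ᶻ *ᶻ m *ᶻ 1ᶻ ≃ 1ᶻ *ᶻ (m *ᶻ 1ᶻ)
  law = solve-∀ ℤ[q]-solvable

q⁻-cancel : ∀ j x → q⁻ j *Q (fromZP (qmono j) *Q x) ≈ x
q⁻-cancel j x =
  ≈-trans (≈-sym (*Q-assoc (q⁻ j) (fromZP (qmono j)) x)) (≈-trans (*Q-congʳ x (q⁻-inverse j)) (*Q-identityˡ x))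

-- * Polynomials over ℚ(q)

PolyQ : Set
PolyQ = List Frac

addXQ : PolyQ → PolyQ → PolyQ
addXQ []      r       = r
addXQ (a ∷ p) []      = a ∷ p
addXQ (a ∷ p) (b ∷ r) = a +Q b ∷ addXQ p r

negXQ : PolyQ → PolyQ
negXQ = map -Q_

scaleXQ : Frac → PolyQ → PolyQ
scaleXQ a = map (a *Q_)

mulXQ : PolyQ → PolyQ → PolyQ
mulXQ []      r = []
mulXQ (a ∷ p) r = addXQ (scaleXQ a r) (0Q ∷ mulXQ p r)

evalXQ : PolyQ → Frac → Frac
evalXQ []      x = 0Q
evalXQ (a ∷ p) x = a +Q x *Q evalXQ p x

map-val-addXQ : ∀ p r → map val (addXQ p r) ≡ addX (map val p) (map val r)
map-val-addXQ []      r       = refl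
map-val-addXQ (a ∷ p) []      = refl
map-val-addXQ (a ∷ p) (b ∷ r) = cong (val (a +Q b) ∷_) (map-val-addXQ p r)

map-val-negXQ : ∀ p → map val (negXQ p) ≡ negX (map val p)
map-val-negXQ []      = refl
map-val-negXQ (a ∷ p) = cong (val (-Q a) ∷_) (map-val-negXQ p)

map-val-scaleXQ : ∀ a p → map val (scaleXQ a p) ≡ scaleX (val a) (map val p)
map-val-scaleXQ a []      = refl
map-val-scaleXQ a (b ∷ p) = cong (val (a *Q b) ∷_) (map-val-scaleXQ a p)

map-val-mulXQ : ∀ p r → map val (mulXQ p r) ≡ mulX (map val p) (map val r)
map-val-mulXQ []      r = refl
map-val-mulXQ (a ∷ p) r = trans (map-val-addXQ (scaleXQ a r) (0Q ∷ mulXQ p r))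
  (cong₂ addX (map-val-scaleXQ a r) (cong (0r ∷_) (map-val-mulXQ p r)))

evalX-map-val : ∀ p x → evalX (map val p) (val x) ≡ val (evalXQ p x)
evalX-map-val []      x = refl
evalX-map-val (a ∷ p) x = cong (λ e → val a +ʳ (val x *ʳ e)) (evalX-map-val p x)

coeffXQ : PolyQ → ℕ → Frac
coeffXQ []      i       = 0Q
coeffXQ (a ∷ p) zero    = a
coeffXQ (a ∷ p) (suc i) = coeffXQ p i

infix 4 _≋_
_≋_ : PolyQ → PolyQ → Set
p ≋ r = ∀ i → coeffXQ p i ≈ coeffXQ r i

module ℚ[q]-Reasoning = SetoidReasoning (CommutativeRing.setoid ℚ[q])
module +-ℚ[q] = GroupProperties (CommutativeRing.+-group ℚ[q])

coeff-addXQ : ∀ p r i → coeffXQ (addXQ p r) i ≈ coeffXQ p i +Q coeffXQ r i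
coeff-addXQ []      r       i       = ≈-sym (+Q-identityˡ _)
coeff-addXQ (a ∷ p) []      zero    = ≈-sym (+Q-identityʳ a)
coeff-addXQ (a ∷ p) []      (suc i) = ≈-sym (+Q-identityʳ _)
coeff-addXQ (a ∷ p) (b ∷ r) zero    = ≈-refl
coeff-addXQ (a ∷ p) (b ∷ r) (suc i) = coeff-addXQ p r i

coeff-negXQ : ∀ p i → coeffXQ (negXQ p) i ≈ -Q coeffXQ p i
coeff-negXQ []      i       = mk≈ ≃-refl
coeff-negXQ (a ∷ p) zero    = ≈-refl
coeff-negXQ (a ∷ p) (suc i) = coeff-negXQ p i

coeff-scaleXQ : ∀ a p i → coeffXQ (scaleXQ a p) i ≈ a *Q coeffXQ p i
coeff-scaleXQ a []      i       = ≈-sym (*Q-zeroʳ a)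
coeff-scaleXQ a (b ∷ p) zero    = ≈-refl
coeff-scaleXQ a (b ∷ p) (suc i) = coeff-scaleXQ a p i

coeff-subXQ : ∀ p r i → coeffXQ (addXQ p (negXQ r)) i ≈ coeffXQ p i +Q -Q coeffXQ r i
coeff-subXQ p r i = ≈-trans (coeff-addXQ p (negXQ r) i) (+Q-congˡ (coeffXQ p i) (coeff-negXQ r i))

≋⇒coeff-sub≈0 : ∀ p r → p ≋ r → ∀ i → coeffXQ (addXQ p (negXQ r)) i ≈ 0Q
≋⇒coeff-sub≈0 p r p≋r i = ≈-trans (coeff-subXQ p r i) (+-ℚ[q].x≈y⇒x∙y⁻¹≈ε (p≋r i))

coeff-sub≈0⇒≋ : ∀ p r → (∀ i → coeffXQ (addXQ p (negXQ r)) i ≈ 0Q) → p ≋ r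
coeff-sub≈0⇒≋ p r z i = +-ℚ[q].x∙y⁻¹≈ε⇒x≈y _ _ (≈-trans (≈-sym (coeff-subXQ p r i)) (z i))

AllZero : PolyX → Set
AllZero = All (λ c → IsZeroP (num c))

AllZero⇒coeff≈0 : ∀ s → AllZero (map val s) → ∀ i → coeffXQ s i ≈ 0Q
AllZero⇒coeff≈0 []      []       i       = ≈-refl
AllZero⇒coeff≈0 (a ∷ s) (z ∷ zs) zero    = num≃[]⇒≈0Q (IsZeroP⇒≃[] z)
AllZero⇒coeff≈0 (a ∷ s) (z ∷ zs) (suc i) = AllZero⇒coeff≈0 s zs i

coeff≈0⇒AllZero : ∀ s → (∀ i → coeffXQ s i ≈ 0Q) → AllZero (map val s)
coeff≈0⇒AllZero []      z = []
coeff≈0⇒AllZero (a ∷ s) z = ≃[]⇒IsZeroP (≈0Q⇒num≃[] (z zero)) ∷ coeff≈0⇒AllZero s (λ i → z (suc i))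

map-val-sub : ∀ p r → map val (addXQ p (negXQ r)) ≡ addX (map val p) (negX (map val r))
map-val-sub p r = trans (map-val-addXQ p (negXQ r)) (cong (addX (map val p)) (map-val-negXQ r))

≋⇒≈ₓ : ∀ p r → p ≋ r → map val p ≈ₓ map val r
≋⇒≈ₓ p r p≋r = subst AllZero (map-val-sub p r) (coeff≈0⇒AllZero _ (≋⇒coeff-sub≈0 p r p≋r))

≈ₓ⇒≋ : ∀ p r → map val p ≈ₓ map val r → p ≋ r
≈ₓ⇒≋ p r e = coeff-sub≈0⇒≋ p r (AllZero⇒coeff≈0 _ (subst AllZero (sym (map-val-sub p r)) e))

[_]Q : ℕ → Frac
[ n ]Q = fromZP (qint n)

InA⇒IsLaurent : ∀ p → InA (map val p) → ∀ n → IsLaurent (evalXQ p [ n ]Q)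
InA⇒IsLaurent p inA n = InLaurent⇒IsLaurent (subst InLaurent (evalX-map-val p [ n ]Q) (inA n))

IsLaurent⇒InA : ∀ p → (∀ n → IsLaurent (evalXQ p [ n ]Q)) → InA (map val p)
IsLaurent⇒InA p h n = subst InLaurent (sym (evalX-map-val p [ n ]Q)) (IsLaurent⇒InLaurent (h n))

module _ (u v : Frac) where
  open ℚ[q]-Reasoning

  coeff₀-mulXQ-linear : ∀ p → coeffXQ (mulXQ p (u ∷ v ∷ [])) 0 ≈ coeffXQ p 0 *Q u
  coeff₀-mulXQ-linear []      = ≈-sym (*Q-zeroˡ u)
  coeff₀-mulXQ-linear (a ∷ p) = +Q-identityʳ (a *Q u)

  coeff-mulXQ-linear : ∀ p i → coeffXQ (mulXQ p (u ∷ v ∷ [])) (suc i) ≈ coeffXQ p (suc i) *Q u +Q coeffXQ p i *Q v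
  coeff-mulXQ-linear []      i       = ≈-sym (≈-trans (+Q-cong (*Q-zeroˡ u) (*Q-zeroˡ v)) (+Q-identityʳ 0Q))
  coeff-mulXQ-linear (a ∷ p) zero    = begin
    coeffXQ (addXQ (a *Q v ∷ []) (mulXQ p (u ∷ v ∷ []))) 0
      ≈⟨ coeff-addXQ (a *Q v ∷ []) (mulXQ p (u ∷ v ∷ [])) 0 ⟩
    a *Q v +Q coeffXQ (mulXQ p (u ∷ v ∷ [])) 0   ≈⟨ +Q-congˡ (a *Q v) (coeff₀-mulXQ-linear p) ⟩
    a *Q v +Q coeffXQ p 0 *Q u                    ≈⟨ +Q-comm (a *Q v) (coeffXQ p 0 *Q u) ⟩
    coeffXQ p 0 *Q u +Q a *Q v                    ∎
  coeff-mulXQ-linear (a ∷ p) (suc i) = begin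
    coeffXQ (addXQ (a *Q v ∷ []) (mulXQ p (u ∷ v ∷ []))) (suc i)
      ≈⟨ coeff-addXQ (a *Q v ∷ []) (mulXQ p (u ∷ v ∷ [])) (suc i) ⟩
    0Q +Q coeffXQ (mulXQ p (u ∷ v ∷ [])) (suc i)
      ≈⟨ +Q-identityˡ _ ⟩
    coeffXQ (mulXQ p (u ∷ v ∷ [])) (suc i)
      ≈⟨ coeff-mulXQ-linear p i ⟩
    coeffXQ p (suc i) *Q u +Q coeffXQ p i *Q v    ∎

module _ (x : Frac) where
  open ℚ[q]-Reasoning

  eval-addXQ : ∀ p r → evalXQ (addXQ p r) x ≈ evalXQ p x +Q evalXQ r x
  eval-addXQ []      r       = ≈-sym (+Q-identityˡ (evalXQ r x))
  eval-addXQ (a ∷ p) []      = ≈-sym (+Q-identityʳ (evalXQ (a ∷ p) x))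
  eval-addXQ (a ∷ p) (b ∷ r) = begin
    a +Q b +Q x *Q evalXQ (addXQ p r) x             ≈⟨ +Q-congˡ (a +Q b) (*Q-congˡ x (eval-addXQ p r)) ⟩
    a +Q b +Q x *Q (evalXQ p x +Q evalXQ r x)       ≈⟨ shuffle a b x (evalXQ p x) (evalXQ r x) ⟩
    a +Q x *Q evalXQ p x +Q (b +Q x *Q evalXQ r x)  ∎
    where
    shuffle : ∀ a b x e f → a +Q b +Q x *Q (e +Q f) ≈ a +Q x *Q e +Q (b +Q x *Q f)
    shuffle = solve-∀ ℚ[q]-solvable

  eval-scaleXQ : ∀ a p → evalXQ (scaleXQ a p) x ≈ a *Q evalXQ p x
  eval-scaleXQ a []      = ≈-sym (*Q-zeroʳ a)
  eval-scaleXQ a (b ∷ p) = begin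
    a *Q b +Q x *Q evalXQ (scaleXQ a p) x   ≈⟨ +Q-congˡ (a *Q b) (*Q-congˡ x (eval-scaleXQ a p)) ⟩
    a *Q b +Q x *Q (a *Q evalXQ p x)        ≈⟨ factor a b x (evalXQ p x) ⟩
    a *Q (b +Q x *Q evalXQ p x)             ∎
    where
    factor : ∀ a b x e → a *Q b +Q x *Q (a *Q e) ≈ a *Q (b +Q x *Q e)
    factor = solve-∀ ℚ[q]-solvable

  eval-mulXQ : ∀ p r → evalXQ (mulXQ p r) x ≈ evalXQ p x *Q evalXQ r x
  eval-mulXQ []      r = ≈-sym (*Q-zeroˡ (evalXQ r x))
  eval-mulXQ (a ∷ p) r = begin
    evalXQ (addXQ (scaleXQ a r) (0Q ∷ mulXQ p r)) x
      ≈⟨ eval-addXQ (scaleXQ a r) (0Q ∷ mulXQ p r) ⟩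
    evalXQ (scaleXQ a r) x +Q (0Q +Q x *Q evalXQ (mulXQ p r) x)
      ≈⟨ +Q-cong (eval-scaleXQ a r) (+Q-congˡ 0Q (*Q-congˡ x (eval-mulXQ p r))) ⟩
    a *Q evalXQ r x +Q (0Q +Q x *Q (evalXQ p x *Q evalXQ r x))
      ≈⟨ factor a x (evalXQ p x) (evalXQ r x) ⟩
    (a +Q x *Q evalXQ p x) *Q evalXQ r x
      ∎
    where
    factor : ∀ a x e f → a *Q f +Q (0Q +Q x *Q (e *Q f)) ≈ (a +Q x *Q e) *Q f
    factor = solve-∀ ℚ[q]-solvable

  eval-coeff≈0 : ∀ p → (∀ i → coeffXQ p i ≈ 0Q) → evalXQ p x ≈ 0Q
  eval-coeff≈0 []      z = ≈-refl
  eval-coeff≈0 (a ∷ p) z = begin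
    a +Q x *Q evalXQ p x   ≈⟨ +Q-cong (z 0) (*Q-congˡ x (eval-coeff≈0 p (λ i → z (suc i)))) ⟩
    0Q +Q x *Q 0Q          ≈⟨ +Q-identityˡ (x *Q 0Q) ⟩
    x *Q 0Q                ≈⟨ *Q-zeroʳ x ⟩
    0Q                     ∎

  eval-≋ : ∀ p r → p ≋ r → evalXQ p x ≈ evalXQ r x
  eval-≋ []      r       p≋r = ≈-sym (eval-coeff≈0 r (λ i → ≈-sym (p≋r i)))
  eval-≋ (a ∷ p) []      p≋r = eval-coeff≈0 (a ∷ p) p≋r
  eval-≋ (a ∷ p) (b ∷ r) p≋r = +Q-cong (p≋r 0) (*Q-congˡ x (eval-≋ p r (λ i → p≋r (suc i))))

-- * Gaussian binomial coefficients

qint-+ : ∀ a b → qint (a + b) ≃ qint a +ᶻ qmono a *ᶻ qint b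
qint-+ zero    b = ≃-sym (mulP-identityˡ (qint b))
qint-+ (suc a) b =
  ≃-trans (∷-cong refl (qint-+ a b)) (≃-sym (addP-cong (≃-refl {1ℤ ∷ qint a}) (mulP-shiftˡ (qmono a) (qint b))))

-- qbinom n k is [n + k choose k]_q, defined by the q-Pascal rule.
qbinom : ℕ → ℕ → ZPoly
qbinom n       zero    = 1ᶻ
qbinom zero    (suc k) = 1ᶻ
qbinom (suc n) (suc k) = qbinom n (suc k) +ᶻ qmono (suc n) *ᶻ qbinom (suc n) k

qrising : ℕ → ℕ → ZPoly
qrising n zero    = 1ᶻ
qrising n (suc k) = qrising n k *ᶻ qint (suc k + n)

qint-cong : ∀ {a b} → a ≡ b → qint a ≃ qint b
qint-cong refl = ≃-refl

qrising-suc : ∀ n k → qrising n (suc k) ≃ qint (suc n) *ᶻ qrising (suc n) k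
qrising-suc n zero    = mulP-comm 1ᶻ (qint (suc n))
qrising-suc n (suc k) = begin
  qrising n (suc k) *ᶻ qint (suc (suc k) + n)               ≈⟨ mulP-cong (qrising-suc n k) (qint-cong (sym (ℕ.+-suc (suc k) n))) ⟩
  qint (suc n) *ᶻ qrising (suc n) k *ᶻ qint (suc k + suc n) ≈⟨ mulP-assoc (qint (suc n)) (qrising (suc n) k) _ ⟩
  qint (suc n) *ᶻ qrising (suc n) (suc k)                   ∎
  where open ℤ[q]-Reasoning

qrising-zero : ∀ k → qrising 0 k ≃ qfact k
qrising-zero zero    = ≃-refl
qrising-zero (suc k) =
  ≃-trans (mulP-cong (qrising-zero k) (qint-cong (ℕ.+-identityʳ (suc k)))) (mulP-comm (qfact k) (qint (suc k)))

qrising≃qfact*qbinom : ∀ n k → qrising n k ≃ qfact k *ᶻ qbinom n k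
qrising≃qfact*qbinom n       zero    = ≃-sym (mulP-identityˡ 1ᶻ)
qrising≃qfact*qbinom zero    (suc k) = ≃-trans (qrising-zero (suc k)) (≃-sym (mulP-identityʳ (qfact (suc k))))
qrising≃qfact*qbinom (suc n) (suc k) = begin
  qrising (suc n) k *ᶻ qint (suc k + suc n)
    ≈⟨ mulP-congʳ (qrising (suc n) k) (≃-trans (qint-cong (ℕ.+-comm (suc k) (suc n))) (qint-+ (suc n) (suc k))) ⟩
  qrising (suc n) k *ᶻ (qint (suc n) +ᶻ qmono (suc n) *ᶻ qint (suc k))
    ≈⟨ distrib (qrising (suc n) k) (qint (suc n)) (qmono (suc n)) (qint (suc k)) ⟩
  qint (suc n) *ᶻ qrising (suc n) k +ᶻ qmono (suc n) *ᶻ qint (suc k) *ᶻ qrising (suc n) k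
    ≈⟨ addP-cong (≃-trans (≃-sym (qrising-suc n k)) (qrising≃qfact*qbinom n (suc k)))
                 (mulP-congʳ (qmono (suc n) *ᶻ qint (suc k)) (qrising≃qfact*qbinom (suc n) k)) ⟩
  qint (suc k) *ᶻ qfact k *ᶻ qbinom n (suc k) +ᶻ qmono (suc n) *ᶻ qint (suc k) *ᶻ (qfact k *ᶻ qbinom (suc n) k)
    ≈⟨ collect (qint (suc k)) (qfact k) (qbinom n (suc k)) (qmono (suc n)) (qbinom (suc n) k) ⟩
  qint (suc k) *ᶻ qfact k *ᶻ (qbinom n (suc k) +ᶻ qmono (suc n) *ᶻ qbinom (suc n) k)
    ∎
  where
  open ℤ[q]-Reasoning
  distrib : ∀ r a m b → r *ᶻ (a +ᶻ m *ᶻ b) ≃ a *ᶻ r +ᶻ m *ᶻ b *ᶻ r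
  distrib = solve-∀ ℤ[q]-solvable
  collect : ∀ b f g m h → b *ᶻ f *ᶻ g +ᶻ m *ᶻ b *ᶻ (f *ᶻ h) ≃ b *ᶻ f *ᶻ (g +ᶻ m *ᶻ h)
  collect = solve-∀ ℤ[q]-solvable

-- * The polynomials B_k

linFactorQ : ℕ → PolyQ
linFactorQ j = fromZP (qint j) ∷ fromZP (qmono j) ∷ []

prodBQ : ℕ → PolyQ
prodBQ zero    = 1Q ∷ []
prodBQ (suc k) = mulXQ (prodBQ k) (linFactorQ (suc k))

qfact⁻¹ : ℕ → Frac
qfact⁻¹ k = frac (1ᶻ / qfact k) (λ z → ≄[]-qfact k (IsZeroP⇒≃[] z))

BQ : ℕ → PolyQ
BQ k = scaleXQ (qfact⁻¹ k) (prodBQ k)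

map-val-prodBQ : ∀ k → map val (prodBQ k) ≡ prodB k
map-val-prodBQ zero    = refl
map-val-prodBQ (suc k) =
  trans (map-val-mulXQ (prodBQ k) (linFactorQ (suc k))) (cong (λ p → mulX p (linFactor (suc k))) (map-val-prodBQ k))

map-val-BQ : ∀ k → map val (BQ k) ≡ B k
map-val-BQ k = trans (map-val-scaleXQ (qfact⁻¹ k) (prodBQ k)) (cong (scaleX (1ᶻ / qfact k)) (map-val-prodBQ k))

module _ (n : ℕ) where
  open ℚ[q]-Reasoning

  eval-linFactorQ : ∀ j → evalXQ (linFactorQ j) [ n ]Q ≈ fromZP (qint (j + n))
  eval-linFactorQ j = begin
    fromZP (qint j) +Q [ n ]Q *Q (fromZP (qmono j) +Q [ n ]Q *Q 0Q)
      ≈⟨ drop (fromZP (qint j)) [ n ]Q (fromZP (qmono j)) ⟩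
    fromZP (qint j) +Q fromZP (qmono j) *Q [ n ]Q
      ≈⟨ ≈-sym (≈-trans (fromZP-+ (qint j) _) (+Q-congˡ (fromZP (qint j)) (fromZP-* (qmono j) (qint n)))) ⟩
    fromZP (qint j +ᶻ qmono j *ᶻ qint n)
      ≈⟨ fromZP-cong (≃-sym (qint-+ j n)) ⟩
    fromZP (qint (j + n)) ∎
    where
    drop : ∀ a x m → a +Q x *Q (m +Q x *Q 0Q) ≈ a +Q m *Q x
    drop = solve-∀ ℚ[q]-solvable

  eval-prodBQ : ∀ k → evalXQ (prodBQ k) [ n ]Q ≈ fromZP (qrising n k)
  eval-prodBQ zero    = ≈-trans (+Q-congˡ 1Q (*Q-zeroʳ [ n ]Q)) (+Q-identityʳ 1Q)
  eval-prodBQ (suc k) = begin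
    evalXQ (mulXQ (prodBQ k) (linFactorQ (suc k))) [ n ]Q
      ≈⟨ eval-mulXQ [ n ]Q (prodBQ k) (linFactorQ (suc k)) ⟩
    evalXQ (prodBQ k) [ n ]Q *Q evalXQ (linFactorQ (suc k)) [ n ]Q
      ≈⟨ *Q-cong (eval-prodBQ k) (eval-linFactorQ (suc k)) ⟩
    fromZP (qrising n k) *Q fromZP (qint (suc k + n))
      ≈⟨ ≈-sym (fromZP-* (qrising n k) (qint (suc k + n))) ⟩
    fromZP (qrising n (suc k)) ∎

  eval-BQ : ∀ k → evalXQ (BQ k) [ n ]Q ≈ fromZP (qbinom n k)
  eval-BQ k = begin
    evalXQ (scaleXQ (qfact⁻¹ k) (prodBQ k)) [ n ]Q  ≈⟨ eval-scaleXQ [ n ]Q (qfact⁻¹ k) (prodBQ k) ⟩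
    qfact⁻¹ k *Q evalXQ (prodBQ k) [ n ]Q           ≈⟨ *Q-congˡ (qfact⁻¹ k) (eval-prodBQ k) ⟩
    qfact⁻¹ k *Q fromZP (qrising n k)               ≈⟨ *Q-congˡ (qfact⁻¹ k) (fromZP-cong (qrising≃qfact*qbinom n k)) ⟩
    qfact⁻¹ k *Q fromZP (qfact k *ᶻ qbinom n k)     ≈⟨ mk≈ (cancel (qfact k) (qbinom n k)) ⟩
    fromZP (qbinom n k)                              ∎
    where
    cancel : ∀ f g → 1ᶻ *ᶻ (f *ᶻ g) *ᶻ 1ᶻ ≃ g *ᶻ (f *ᶻ 1ᶻ)
    cancel = solve-∀ ℤ[q]-solvable

B-InA : ∀ k → InA (B k)
B-InA k = subst InA (map-val-BQ k)
  (IsLaurent⇒InA (BQ k) λ n → IsLaurent-resp (≈-sym (eval-BQ n k)) (IsLaurent-fromZP (qbinom n k)))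

≉0-fromZP : ∀ {p} → ¬ p ≃ [] → ¬ fromZP p ≈ 0Q
≉0-fromZP p≄0 z = p≄0 (≈0Q⇒num≃[] z)

≈0-*Q-cancelʳ : ∀ {r s} → ¬ s ≈ 0Q → r *Q s ≈ 0Q → r ≈ 0Q
≈0-*Q-cancelʳ {r} {s} s≉0 rs≈0 with *Q-zero⇒ r s rs≈0
... | inj₁ r≈0 = r≈0
... | inj₂ s≈0 = ⊥-elim (s≉0 s≈0)

≉0-*Q : ∀ {r s} → ¬ r ≈ 0Q → ¬ s ≈ 0Q → ¬ r *Q s ≈ 0Q
≉0-*Q {r} {s} r≉0 s≉0 rs≈0 with *Q-zero⇒ r s rs≈0
... | inj₁ r≈0 = r≉0 r≈0
... | inj₂ s≈0 = s≉0 s≈0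

module _ where
  open ℚ[q]-Reasoning

  private
    [_+1] q^[_+1] : ℕ → Frac
    [ k +1]   = fromZP (qint (suc k))
    q^[ k +1] = fromZP (qmono (suc k))

  coeff-prodBQ-suc : ∀ k i → coeffXQ (prodBQ (suc k)) (suc i)
                           ≈ coeffXQ (prodBQ k) (suc i) *Q [ k +1] +Q coeffXQ (prodBQ k) i *Q q^[ k +1]
  coeff-prodBQ-suc k = coeff-mulXQ-linear [ k +1] q^[ k +1] (prodBQ k)

  prodBQ-coeff-high : ∀ k i → k < i → coeffXQ (prodBQ k) i ≈ 0Q
  prodBQ-coeff-high zero    (suc i) k<i       = ≈-refl
  prodBQ-coeff-high (suc k) (suc i) (s≤s k<i) = begin
    coeffXQ (prodBQ (suc k)) (suc i)
      ≈⟨ coeff-prodBQ-suc k i ⟩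
    coeffXQ (prodBQ k) (suc i) *Q [ k +1] +Q coeffXQ (prodBQ k) i *Q q^[ k +1]
      ≈⟨ +Q-cong (*Q-congʳ [ k +1] (prodBQ-coeff-high k (suc i) (ℕ.m<n⇒m<1+n k<i)))
                 (*Q-congʳ q^[ k +1] (prodBQ-coeff-high k i k<i)) ⟩
    0Q *Q [ k +1] +Q 0Q *Q q^[ k +1]
      ≈⟨ +Q-cong (*Q-zeroˡ [ k +1]) (*Q-zeroˡ q^[ k +1]) ⟩
    0Q +Q 0Q
      ≈⟨ +Q-identityʳ 0Q ⟩
    0Q ∎

  prodBQ-coeff-top : ∀ k → ¬ coeffXQ (prodBQ k) k ≈ 0Q
  prodBQ-coeff-top zero    = ≉0-fromZP ≄[]-1
  prodBQ-coeff-top (suc k) top≈0 =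
    ≉0-*Q (prodBQ-coeff-top k) (≉0-fromZP (≄[]-qmono (suc k))) (begin
      coeffXQ (prodBQ k) k *Q q^[ k +1]
        ≈⟨ +Q-identityˡ (coeffXQ (prodBQ k) k *Q q^[ k +1]) ⟨
      0Q +Q coeffXQ (prodBQ k) k *Q q^[ k +1]
        ≈⟨ +Q-congʳ (coeffXQ (prodBQ k) k *Q q^[ k +1]) below ⟨
      coeffXQ (prodBQ k) (suc k) *Q [ k +1] +Q coeffXQ (prodBQ k) k *Q q^[ k +1]
        ≈⟨ coeff-prodBQ-suc k k ⟨
      coeffXQ (prodBQ (suc k)) (suc k)
        ≈⟨ top≈0 ⟩
      0Q ∎)
    where
    below : coeffXQ (prodBQ k) (suc k) *Q [ k +1] ≈ 0Q
    below = ≈-trans (*Q-congʳ [ k +1] (prodBQ-coeff-high k (suc k) (ℕ.n<1+n k))) (*Q-zeroˡ [ k +1])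

  BQ-coeff-high : ∀ k i → k < i → coeffXQ (BQ k) i ≈ 0Q
  BQ-coeff-high k i k<i =
    ≈-trans (coeff-scaleXQ (qfact⁻¹ k) (prodBQ k) i)
      (≈-trans (*Q-congˡ (qfact⁻¹ k) (prodBQ-coeff-high k i k<i)) (*Q-zeroʳ (qfact⁻¹ k)))

  BQ-coeff-top : ∀ k → ¬ coeffXQ (BQ k) k ≈ 0Q
  BQ-coeff-top k top≈0 =
    ≉0-*Q {qfact⁻¹ k} (λ z → ≄[]-1 (≈0Q⇒num≃[] z)) (prodBQ-coeff-top k)
      (≈-trans (≈-sym (coeff-scaleXQ (qfact⁻¹ k) (prodBQ k) k)) top≈0)

-- * Combinations of the B_k

sumBQ : ℕ → (ℕ → Frac) → PolyQ
sumBQ zero    a = []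
sumBQ (suc N) a = addXQ (sumBQ N a) (scaleXQ (a N) (BQ N))

map-val-sumBQ : ∀ N c → map val (sumBQ N (λ k → toRatQ (c k))) ≡ sumB N c
map-val-sumBQ zero    c = refl
map-val-sumBQ (suc N) c = trans (map-val-addXQ (sumBQ N c′) (scaleXQ (c′ N) (BQ N)))
  (cong₂ addX (map-val-sumBQ N c) (trans (map-val-scaleXQ (c′ N) (BQ N)) (cong (scaleX (toRat (c N))) (map-val-BQ N))))
  where
  c′ : ℕ → Frac
  c′ k = toRatQ (c k)

coeff-sumBQ-suc : ∀ N a i → coeffXQ (sumBQ (suc N) a) i ≈ coeffXQ (sumBQ N a) i +Q a N *Q coeffXQ (BQ N) i
coeff-sumBQ-suc N a i =
  ≈-trans (coeff-addXQ (sumBQ N a) (scaleXQ (a N) (BQ N)) i) (+Q-congˡ (coeffXQ (sumBQ N a) i) (coeff-scaleXQ (a N) (BQ N) i))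

sumBQ-cong : ∀ N {a b} → (∀ k → k < N → a k ≈ b k) → sumBQ N a ≋ sumBQ N b
sumBQ-cong zero    a≈b i = ≈-refl
sumBQ-cong (suc N) {a} {b} a≈b i = begin
  coeffXQ (sumBQ (suc N) a) i                            ≈⟨ coeff-sumBQ-suc N a i ⟩
  coeffXQ (sumBQ N a) i +Q a N *Q coeffXQ (BQ N) i        ≈⟨ +Q-cong (sumBQ-cong N (λ k k<N → a≈b k (ℕ.m<n⇒m<1+n k<N)) i)
                                                                     (*Q-congʳ (coeffXQ (BQ N) i) (a≈b N ℕ.≤-refl)) ⟩
  coeffXQ (sumBQ N b) i +Q b N *Q coeffXQ (BQ N) i        ≈⟨ coeff-sumBQ-suc N b i ⟨
  coeffXQ (sumBQ (suc N) b) i                            ∎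
  where open ℚ[q]-Reasoning

module _ (a : ℕ → Frac) where
  open ℚ[q]-Reasoning

  sumBQ-coeff-high : ∀ N i → N ≤ i → coeffXQ (sumBQ N a) i ≈ 0Q
  sumBQ-coeff-high zero    i N≤i = ≈-refl
  sumBQ-coeff-high (suc N) i N<i = begin
    coeffXQ (sumBQ (suc N) a) i                       ≈⟨ coeff-sumBQ-suc N a i ⟩
    coeffXQ (sumBQ N a) i +Q a N *Q coeffXQ (BQ N) i   ≈⟨ +Q-cong (sumBQ-coeff-high N i (ℕ.<⇒≤ N<i))
                                                                  (*Q-congˡ (a N) (BQ-coeff-high N i N<i)) ⟩
    0Q +Q a N *Q 0Q                                    ≈⟨ +Q-identityˡ (a N *Q 0Q) ⟩
    a N *Q 0Q                                          ≈⟨ *Q-zeroʳ (a N) ⟩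
    0Q                                                 ∎

  sumBQ-coeff-top : ∀ N → coeffXQ (sumBQ (suc N) a) N ≈ a N *Q coeffXQ (BQ N) N
  sumBQ-coeff-top N = begin
    coeffXQ (sumBQ (suc N) a) N                       ≈⟨ coeff-sumBQ-suc N a N ⟩
    coeffXQ (sumBQ N a) N +Q a N *Q coeffXQ (BQ N) N   ≈⟨ +Q-congʳ (a N *Q coeffXQ (BQ N) N) (sumBQ-coeff-high N N ℕ.≤-refl) ⟩
    0Q +Q a N *Q coeffXQ (BQ N) N                      ≈⟨ +Q-identityˡ (a N *Q coeffXQ (BQ N) N) ⟩
    a N *Q coeffXQ (BQ N) N                            ∎

sumBQ≋[]⇒top≈0 : ∀ N a → sumBQ (suc N) a ≋ [] → a N ≈ 0Q
sumBQ≋[]⇒top≈0 N a sum≋0 =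
  ≈0-*Q-cancelʳ (BQ-coeff-top N) (≈-trans (≈-sym (sumBQ-coeff-top a N)) (sum≋0 N))

sumBQ≋[]⇒≈0 : ∀ N a → sumBQ N a ≋ [] → ∀ k → k < N → a k ≈ 0Q
sumBQ≋[]⇒≈0 (suc N) a sum≋0 k k<1+N with ℕ.m<1+n⇒m<n∨m≡n k<1+N
... | inj₁ k<N  = sumBQ≋[]⇒≈0 N a lower≋0 k k<N
  where
  open ℚ[q]-Reasoning
  lower≋0 : sumBQ N a ≋ []
  lower≋0 i = begin
    coeffXQ (sumBQ N a) i                              ≈⟨ +Q-identityʳ (coeffXQ (sumBQ N a) i) ⟨
    coeffXQ (sumBQ N a) i +Q 0Q                        ≈⟨ +Q-congˡ (coeffXQ (sumBQ N a) i) (*Q-zeroˡ (coeffXQ (BQ N) i)) ⟨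
    coeffXQ (sumBQ N a) i +Q 0Q *Q coeffXQ (BQ N) i     ≈⟨ +Q-congˡ (coeffXQ (sumBQ N a) i) (*Q-congʳ (coeffXQ (BQ N) i) (sumBQ≋[]⇒top≈0 N a sum≋0)) ⟨
    coeffXQ (sumBQ N a) i +Q a N *Q coeffXQ (BQ N) i    ≈⟨ coeff-sumBQ-suc N a i ⟨
    coeffXQ (sumBQ (suc N) a) i                        ≈⟨ sum≋0 i ⟩
    0Q                                                  ∎
... | inj₂ refl = sumBQ≋[]⇒top≈0 N a sum≋0

-- * Every polynomial of ℚ(q)[x] is a combination of the B_k

extend : (ℕ → Frac) → ℕ → Frac → ℕ → Frac
extend a d v k with k <? d
... | yes _ = a k
... | no  _ = v

extend-below : ∀ a d v k → k < d → extend a d v k ≡ a k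
extend-below a d v k k<d with k <? d
... | yes _   = refl
... | no  k≮d = ⊥-elim (k≮d k<d)

extend-at : ∀ a d v → extend a d v d ≡ v
extend-at a d v with d <? d
... | yes d<d = ⊥-elim (ℕ.<-irrefl refl d<d)
... | no  _   = refl

peelCoeff : ℕ → PolyQ → Frac
peelCoeff d p = coeffXQ p d ÷ coeffXQ (BQ d) d ⟨ BQ-coeff-top d ⟩

peelBQ : ℕ → PolyQ → PolyQ
peelBQ d p = addXQ p (negXQ (scaleXQ (peelCoeff d p) (BQ d)))

module _ (d : ℕ) (p : PolyQ) where
  open ℚ[q]-Reasoning

  private
    v : Frac
    v = peelCoeff d p

  coeff-peelBQ : ∀ i → coeffXQ (peelBQ d p) i ≈ coeffXQ p i +Q -Q (v *Q coeffXQ (BQ d) i)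
  coeff-peelBQ i = ≈-trans (coeff-subXQ p (scaleXQ v (BQ d)) i)
    (+Q-congˡ (coeffXQ p i) (-Q-cong (coeff-scaleXQ v (BQ d) i)))

  peelBQ-above : ∀ i → d < i → coeffXQ p i ≈ 0Q → coeffXQ (peelBQ d p) i ≈ 0Q
  peelBQ-above i d<i pᵢ≈0 = begin
    coeffXQ (peelBQ d p) i                        ≈⟨ coeff-peelBQ i ⟩
    coeffXQ p i +Q -Q (v *Q coeffXQ (BQ d) i)      ≈⟨ +Q-cong pᵢ≈0 (-Q-cong (*Q-congˡ v (BQ-coeff-high d i d<i))) ⟩
    0Q +Q -Q (v *Q 0Q)                             ≈⟨ +Q-identityˡ (-Q (v *Q 0Q)) ⟩
    -Q (v *Q 0Q)                                   ≈⟨ -Q-cong (*Q-zeroʳ v) ⟩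
    -Q 0Q                                          ≈⟨ mk≈ ≃-refl ⟩
    0Q                                             ∎

  peelBQ-at : coeffXQ (peelBQ d p) d ≈ 0Q
  peelBQ-at = begin
    coeffXQ (peelBQ d p) d                          ≈⟨ coeff-peelBQ d ⟩
    coeffXQ p d +Q -Q (v *Q coeffXQ (BQ d) d)        ≈⟨ +Q-congˡ (coeffXQ p d) (-Q-cong (÷-*Q (coeffXQ p d) (coeffXQ (BQ d) d) (BQ-coeff-top d))) ⟩
    coeffXQ p d +Q -Q (coeffXQ p d)                  ≈⟨ +Q-inverseʳ (coeffXQ p d) ⟩
    0Q                                               ∎

  peelBQ-high≈0 : (∀ i → suc d ≤ i → coeffXQ p i ≈ 0Q) → ∀ i → d ≤ i → coeffXQ (peelBQ d p) i ≈ 0Q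
  peelBQ-high≈0 high≈0 i d≤i = [ (λ d<i → peelBQ-above i d<i (high≈0 i d<i))
                               , (λ d≡i → subst (λ j → coeffXQ (peelBQ d p) j ≈ 0Q) d≡i peelBQ-at)
                               ]′ (ℕ.m≤n⇒m<n∨m≡n d≤i)

  peelBQ-restore : ∀ i → coeffXQ p i ≈ coeffXQ (peelBQ d p) i +Q v *Q coeffXQ (BQ d) i
  peelBQ-restore i = begin
    coeffXQ p i                                                    ≈⟨ cancel (coeffXQ p i) (v *Q coeffXQ (BQ d) i) ⟩
    coeffXQ p i +Q -Q (v *Q coeffXQ (BQ d) i) +Q v *Q coeffXQ (BQ d) i
                                                                   ≈⟨ +Q-congʳ (v *Q coeffXQ (BQ d) i) (coeff-peelBQ i) ⟨
    coeffXQ (peelBQ d p) i +Q v *Q coeffXQ (BQ d) i                 ∎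
    where
    cancel : ∀ x y → x ≈ x +Q -Q y +Q y
    cancel = solve-∀ ℚ[q]-solvable

Decomposition : ℕ → PolyQ → Set
Decomposition d p = Σ (ℕ → Frac) λ a → p ≋ sumBQ d a

decomposition-step : ∀ d p → Decomposition d (peelBQ d p) → Decomposition (suc d) p
decomposition-step d p (a′ , peel≋sum) = a , λ i → begin
  coeffXQ p i                                        ≈⟨ peelBQ-restore d p i ⟩
  coeffXQ (peelBQ d p) i +Q v *Q coeffXQ (BQ d) i     ≈⟨ +Q-congʳ (v *Q coeffXQ (BQ d) i) (peel≋sum i) ⟩
  coeffXQ (sumBQ d a′) i +Q v *Q coeffXQ (BQ d) i     ≈⟨ +Q-cong (sumBQ-cong d (λ k k<d → ≡⇒≈ (sym (extend-below a′ d v k k<d))) i)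
                                                                 (*Q-congʳ (coeffXQ (BQ d) i) (≡⇒≈ (sym (extend-at a′ d v)))) ⟩
  coeffXQ (sumBQ d a) i +Q a d *Q coeffXQ (BQ d) i    ≈⟨ coeff-sumBQ-suc d a i ⟨
  coeffXQ (sumBQ (suc d) a) i                        ∎
  where
  open ℚ[q]-Reasoning
  v : Frac
  v = peelCoeff d p
  a : ℕ → Frac
  a = extend a′ d v

decompose : ∀ d p → (∀ i → d ≤ i → coeffXQ p i ≈ 0Q) → Decomposition d p
decompose zero    p high≈0 = (λ _ → 0Q) , λ i → high≈0 i z≤n
decompose (suc d) p high≈0 = decomposition-step d p (decompose d (peelBQ d p) (peelBQ-high≈0 d p high≈0))

-- * Laurent coefficients from Laurent values

binomSum : ℕ → (ℕ → Frac) → ℕ → Frac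
binomSum zero    a n = 0Q
binomSum (suc d) a n = binomSum d a n +Q a d *Q fromZP (qbinom n d)

eval-sumBQ : ∀ d a n → evalXQ (sumBQ d a) [ n ]Q ≈ binomSum d a n
eval-sumBQ zero    a n = ≈-refl
eval-sumBQ (suc d) a n = begin
  evalXQ (addXQ (sumBQ d a) (scaleXQ (a d) (BQ d))) [ n ]Q
    ≈⟨ eval-addXQ [ n ]Q (sumBQ d a) (scaleXQ (a d) (BQ d)) ⟩
  evalXQ (sumBQ d a) [ n ]Q +Q evalXQ (scaleXQ (a d) (BQ d)) [ n ]Q
    ≈⟨ +Q-cong (eval-sumBQ d a n) (eval-scaleXQ [ n ]Q (a d) (BQ d)) ⟩
  binomSum d a n +Q a d *Q evalXQ (BQ d) [ n ]Q
    ≈⟨ +Q-congˡ (binomSum d a n) (*Q-congˡ (a d) (eval-BQ n d)) ⟩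
  binomSum (suc d) a n ∎
  where open ℚ[q]-Reasoning

binomSum-difference : ∀ d a n → binomSum (suc d) a (suc n) +Q -Q binomSum (suc d) a n
                                ≈ fromZP (qmono (suc n)) *Q binomSum d (λ k → a (suc k)) (suc n)
binomSum-difference zero    a n = base (a 0) (fromZP (qmono (suc n)))
  where
  base : ∀ a m → 0Q +Q a *Q 1Q +Q -Q (0Q +Q a *Q 1Q) ≈ m *Q 0Q
  base = solve-∀ ℚ[q]-solvable
binomSum-difference (suc d) a n = begin
  S₁ +Q a (suc d) *Q fromZP (qbinom n (suc d) +ᶻ qmono (suc n) *ᶻ qbinom (suc n) d) +Q -Q (S₀ +Q a (suc d) *Q g₀)
    ≈⟨ +Q-congʳ (-Q (S₀ +Q a (suc d) *Q g₀)) (+Q-congˡ S₁ (*Q-congˡ (a (suc d)) pascal)) ⟩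
  S₁ +Q a (suc d) *Q (g₀ +Q m *Q g₁) +Q -Q (S₀ +Q a (suc d) *Q g₀)
    ≈⟨ regroup S₁ S₀ (a (suc d)) g₀ g₁ m ⟩
  S₁ +Q -Q S₀ +Q m *Q (a (suc d) *Q g₁)
    ≈⟨ +Q-congʳ (m *Q (a (suc d) *Q g₁)) (binomSum-difference d a n) ⟩
  m *Q T +Q m *Q (a (suc d) *Q g₁)
    ≈⟨ *Q-distribˡ m T (a (suc d) *Q g₁) ⟨
  m *Q (T +Q a (suc d) *Q g₁) ∎
  where
  open ℚ[q]-Reasoning
  S₁ S₀ T g₀ g₁ m : Frac
  S₁ = binomSum (suc d) a (suc n)
  S₀ = binomSum (suc d) a n
  T  = binomSum d (λ k → a (suc k)) (suc n)
  g₀ = fromZP (qbinom n (suc d))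
  g₁ = fromZP (qbinom (suc n) d)
  m  = fromZP (qmono (suc n))
  pascal : fromZP (qbinom n (suc d) +ᶻ qmono (suc n) *ᶻ qbinom (suc n) d) ≈ g₀ +Q m *Q g₁
  pascal = ≈-trans (fromZP-+ (qbinom n (suc d)) _) (+Q-congˡ g₀ (fromZP-* (qmono (suc n)) (qbinom (suc n) d)))
  regroup : ∀ S₁ S₀ a g₀ g₁ m → S₁ +Q a *Q (g₀ +Q m *Q g₁) +Q -Q (S₀ +Q a *Q g₀) ≈ S₁ +Q -Q S₀ +Q m *Q (a *Q g₁)
  regroup = solve-∀ ℚ[q]-solvable

-- Taking d forward differences isolates the top coefficient; the offset m records
-- how many differences have been taken.
IsLaurent-top : ∀ d m a → (∀ n → IsLaurent (binomSum (suc d) a (n + m))) → IsLaurent (a d)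
IsLaurent-top zero    m a h = IsLaurent-resp (base (a 0)) (h 0)
  where
  base : ∀ a → 0Q +Q a *Q 1Q ≈ a
  base = solve-∀ ℚ[q]-solvable
IsLaurent-top (suc d) m a h = IsLaurent-top d (suc m) (λ k → a (suc k)) shifted
  where
  shifted : ∀ n → IsLaurent (binomSum (suc d) (λ k → a (suc k)) (n + suc m))
  shifted n = subst (λ j → IsLaurent (binomSum (suc d) (λ k → a (suc k)) j)) (sym (ℕ.+-suc n m))
    (IsLaurent-resp (q⁻-cancel (suc (n + m)) (binomSum (suc d) (λ k → a (suc k)) (suc (n + m))))
      (IsLaurent-* (IsLaurent-q⁻ (suc (n + m)))
        (IsLaurent-resp (binomSum-difference (suc d) a (n + m)) (IsLaurent-+ (h (suc n)) (IsLaurent-neg (h n))))))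

IsLaurent-coefficients : ∀ d a → (∀ n → IsLaurent (binomSum d a n)) → ∀ k → k < d → IsLaurent (a k)
IsLaurent-coefficients (suc d) a h k k<1+d =
  [ IsLaurent-coefficients d a lower k , (λ k≡d → subst (λ j → IsLaurent (a j)) (sym k≡d) top) ]′ (ℕ.m<1+n⇒m<n∨m≡n k<1+d)
  where
  top : IsLaurent (a d)
  top = IsLaurent-top d 0 a (λ n → subst (λ j → IsLaurent (binomSum (suc d) a j)) (sym (ℕ.+-identityʳ n)) (h n))
  lower : ∀ n → IsLaurent (binomSum d a n)
  lower n = IsLaurent-resp (drop (binomSum d a n) (a d *Q fromZP (qbinom n d)))
    (IsLaurent-+ (h n) (IsLaurent-neg (IsLaurent-* top (IsLaurent-fromZP (qbinom n d)))))
    where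
    drop : ∀ x y → x +Q y +Q -Q y ≈ x
    drop = solve-∀ ℚ[q]-solvable

liftX : (P : PolyX) → WFX P → PolyQ
liftX []      []       = []
liftX (r ∷ P) (w ∷ ws) = frac r w ∷ liftX P ws

map-val-liftX : ∀ P w → map val (liftX P w) ≡ P
map-val-liftX []      []       = refl
map-val-liftX (r ∷ P) (w ∷ ws) = cong (r ∷_) (map-val-liftX P ws)

coeffXQ-beyond : ∀ p i → length p ≤ i → coeffXQ p i ≈ 0Q
coeffXQ-beyond []      i       _         = ≈-refl
coeffXQ-beyond (a ∷ p) (suc i) (s≤s p≤i) = coeffXQ-beyond p i p≤i

laurentWitnesses : ∀ d (a : ℕ → Frac) → (∀ k → k < d → IsLaurent (a k)) → ℕ → Laurent
laurentWitnesses d a h k with k <? d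
... | yes k<d = proj₁ (h k k<d)
... | no  _   = laurent [] 0

laurentWitnesses-correct : ∀ d (a : ℕ → Frac) (h : ∀ k → k < d → IsLaurent (a k)) k → k < d → toRatQ (laurentWitnesses d a h k) ≈ a k
laurentWitnesses-correct d a h k k<d with k <? d
... | yes k<d′ = proj₂ (h k k<d′)
... | no  k≮d  = ⊥-elim (k≮d k<d)

B-span : (P : PolyX) → WFX P → InA P → Σ ℕ (λ N → Σ (ℕ → Laurent) (λ c → P ≈ₓ sumB N c))
B-span P wf inA = d , c , subst₂ _≈ₓ_ (map-val-liftX P wf) (map-val-sumBQ d c) (≋⇒≈ₓ p (sumBQ d c′) p≋sum)
  where
  p : PolyQ
  p = liftX P wf
  d : ℕ
  d = length p
  decomposition : Decomposition d p
  decomposition = decompose d p (coeffXQ-beyond p)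
  a : ℕ → Frac
  a = proj₁ decomposition
  values : ∀ n → IsLaurent (binomSum d a n)
  values n = IsLaurent-resp (≈-trans (eval-≋ [ n ]Q p (sumBQ d a) (proj₂ decomposition)) (eval-sumBQ d a n))
    (InA⇒IsLaurent p (subst InA (sym (map-val-liftX P wf)) inA) n)
  coefficients : ∀ k → k < d → IsLaurent (a k)
  coefficients = IsLaurent-coefficients d a values
  c : ℕ → Laurent
  c = laurentWitnesses d a coefficients
  c′ : ℕ → Frac
  c′ k = toRatQ (c k)
  p≋sum : p ≋ sumBQ d c′
  p≋sum i = ≈-trans (proj₂ decomposition i)
    (sumBQ-cong d (λ k k<d → ≈-sym (laurentWitnesses-correct d a coefficients k k<d)) i)

B-independent : (N : ℕ) (c : ℕ → Laurent) → sumB N c ≈ₓ [] → (k : ℕ) → k < N → IsZeroP (poly (c k))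
B-independent N c sum≈0 k k<N = ≃[]⇒IsZeroP (≈0Q⇒num≃[] (sumBQ≋[]⇒≈0 N c′ sum≋0 k k<N))
  where
  c′ : ℕ → Frac
  c′ k = toRatQ (c k)
  sum≋0 : sumBQ N c′ ≋ []
  sum≋0 = ≈ₓ⇒≋ (sumBQ N c′) [] (subst (_≈ₓ []) (sym (map-val-sumBQ N c)) sum≈0)

mainTheorem17 : ((k : ℕ) → InA (B k))
    × ((P : PolyX) → WFX P → InA P → Σ ℕ (λ N → Σ (ℕ → Laurent) (λ c → P ≈ₓ sumB N c)))
    × ((N : ℕ) (c : ℕ → Laurent) → sumB N c ≈ₓ [] → (k : ℕ) → k < N → IsZeroP (poly (c k)))
mainTheorem17 = B-InA , B-span , B-independent
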